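{- For all $k\geq 3$, $$\mathcal{D}_{23\dots k1}(x)=1+x+\frac{x^2(1+x)}{1-x^2-x^2F_{k-3}(x)}.$$
   Context: A permutation $\pi$ is a Dumont permutation (of the first kind) if each even integer in $\pi$ is followed by a smaller integer, and each odd integer is either followed by a larger integer or is the last element of $\pi$. For a pattern $\tau$, $\mathcal{D}_\tau(x)=\sum_{n\geq0}\mathcal{D}_\tau(n)x^n$ where $\mathcal{D}_\tau(n)$ is the number of Dumont permutations of length $n$ avoiding both $132$ and $\tau$ (classical patterns). For $r\geq2$ consider $Q_r(x)=1+\frac{x^2Q_{r-1}(x)}{1-x^2Q_{r-2}(x)}$; $F_r(x)$ is its solution with $Q_0(x)=0$, $Q_1(x)=1$. -}

module Defs where

open import Data.Nat as ℕ using (ℕ; zero; suc; _<_; _∸_)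
open import Data.Nat.Divisibility using (_∣_)
open import Data.Integer as ℤ using (ℤ; +_)
open import Data.List using (List; []; _∷_; _++_; map; upTo; foldr)
open import Data.List.Relation.Binary.Sublist.Propositional using (_⊆_)
open import Data.List.Relation.Binary.Pointwise using (Pointwise)
open import Data.List.Relation.Binary.Permutation.Propositional using (_↭_)
open import Data.Product using (_×_; ∃)
open import Data.Sum using (_⊎_)
open import Data.Unit using (⊤)
open import Data.Empty using (⊥)
open import Relation.Nullary using (¬_)
open import Function.Bundles using (_⇔_)

oneTo : ℕ → List ℕ
oneTo n = map suc (upTo n)

IsPerm : ℕ → List ℕ → Set
IsPerm n π = π ↭ oneTo n

Even Odd : ℕ → Set
Even a = 2 ∣ a
Odd a = ¬ (2 ∣ a)

-- Dumont permutation of the first kind: every even entry is followed by a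
-- smaller entry; every odd entry is followed by a larger entry or is last.
Dumont : List ℕ → Set
Dumont [] = ⊤
Dumont (a ∷ []) = Odd a
Dumont (a ∷ b ∷ rest) = ((Even a × b < a) ⊎ (Odd a × a < b)) × Dumont (b ∷ rest)

OrderIso : List ℕ → List ℕ → Set
OrderIso [] [] = ⊤
OrderIso [] (_ ∷ _) = ⊥
OrderIso (_ ∷ _) [] = ⊥
OrderIso (a ∷ s) (b ∷ t) =
  Pointwise (λ x y → (a < x ⇔ b < y) × (x < a ⇔ y < b)) s t × OrderIso s t

Contains : List ℕ → List ℕ → Set
Contains σ π = ∃ λ s → (s ⊆ π) × OrderIso s σ

Avoids : List ℕ → List ℕ → Set
Avoids σ π = ¬ Contains σ π

p132 : List ℕ
p132 = 1 ∷ 3 ∷ 2 ∷ []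

p23k1 : ℕ → List ℕ
p23k1 k = map (2 ℕ.+_) (upTo (k ∸ 1)) ++ (1 ∷ [])

-- Formal power series with integer coefficients: Series = ℕ → ℤ
-- (f n is the coefficient of x^n)

Series : Set
Series = ℕ → ℤ

sumℤ : List ℤ → ℤ
sumℤ = foldr ℤ._+_ (+ 0)

𝟘 𝟙 : Series
𝟘 n = + 0
𝟙 zero = + 1
𝟙 (suc n) = + 0

X : Series
X zero = + 0
X (suc zero) = + 1
X (suc (suc n)) = + 0

_⊕_ _⊖_ _⊛_ : Series → Series → Series
(f ⊕ g) n = f n ℤ.+ g n
(f ⊖ g) n = f n ℤ.- g n
(f ⊛ g) n = sumℤ (map (λ i → f i ℤ.* g (n ∸ i)) (upTo (suc n)))

infixl 6 _⊕_ _⊖_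
infixl 7 _⊛_

pow : Series → ℕ → Series
pow g zero = 𝟙
pow g (suc m) = g ⊛ pow g m

-- multiplicative inverse of a series f with f 0 = 1:
-- 1/f = 1/(1 - g) = Σ_m g^m  where g = 1 - f has zero constant term,
-- so the coefficient of x^n only involves m ≤ n.
inv : Series → Series
inv f n = sumℤ (map (λ m → pow (𝟙 ⊖ f) m n) (upTo (suc n)))

-- division by a series with constant term 1
_⊘_ : Series → Series → Series
f ⊘ g = f ⊛ inv g

infixl 7 _⊘_

F : ℕ → Series
F zero = 𝟘
F (suc zero) = 𝟙
F (suc (suc r)) = 𝟙 ⊕ (X ⊛ X ⊛ F (suc r)) ⊘ (𝟙 ⊖ X ⊛ X ⊛ F r)

RHS : ℕ → Series
RHS k = 𝟙 ⊕ X ⊕ (X ⊛ X ⊛ (𝟙 ⊕ X)) ⊘ (𝟙 ⊖ X ⊛ X ⊖ X ⊛ X ⊛ F (k ∸ 3))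

module Submission where

-- A Dumont permutation of odd length n + 1 is one of even length n followed by n + 1,
-- so only even lengths need to be counted. In an even-length Dumont permutation π
-- avoiding 132, everything before the maximum N = t + 2 exceeds everything after it,
-- and the Dumont conditions force π = N β (N−1) or π = α↑ (N−1) N β with |α| even
-- and β nonempty. Avoiding 12…r (resp. 23…k1) transfers to β as 12…(r−1) (resp. 23…k1)
-- in the first shape and to α, β as 12…(r−2), 12…r (resp. 12…(k−3), 23…k1) in the second.
-- Hence the even-length generating functions G_r (avoiding 12…r) and E (avoiding 23…k1)
-- satisfy G_r = 1 + x²(G_{r−1} + G_{r−2}(G_r − 1)), the defining recurrence of F_r, and
-- E = 1 + x²(E + F_{k−3}(E − 1)), i.e. E = 1 + x²/(1 − x² − x²F_{k−3}); the full
-- generating function is (1 + x)E.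

open import Defs

module PowerSeries where

  open import Data.Nat as ℕ using (ℕ; zero; suc; _∸_; _<_; _≤_; s≤s)
  import Data.Nat.Properties as ℕₚ
  open import Data.Integer as ℤ using (ℤ; +_; -_; _+_; _*_; _-_)
  import Data.Integer.Properties as ℤₚ
  open import Data.Integer.Solver using (module +-*-Solver)
  open import Data.List using (map; upTo; applyUpTo)
  open import Data.Product using (_×_; _,_; proj₁)
  open import Data.Maybe using (Maybe; just; nothing)
  open import Function using (_∘_)
  open import Level using (0ℓ)
  open import Relation.Nullary using (yes; no)
  open import Relation.Binary.PropositionalEquality
    using (_≡_; _≗_; refl; sym; trans; cong; cong₂; module ≡-Reasoning)
  open import Algebra.Bundles using (CommutativeRing)
  open import Algebra.Solver.Ring.AlmostCommutativeRing
    using (fromCommutativeRing; _-Raw-AlmostCommutative⟶_)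
  import Algebra.Solver.Ring as RingSolver
  import Relation.Binary.Reasoning.Setoid

  ∑ : ℕ → (ℕ → ℤ) → ℤ
  ∑ zero f = + 0
  ∑ (suc n) f = f 0 + ∑ n (f ∘ suc)

  sumℤ-applyUpTo : ∀ n (f : ℕ → ℤ) g → sumℤ (map f (applyUpTo g n)) ≡ ∑ n (f ∘ g)
  sumℤ-applyUpTo zero f g = refl
  sumℤ-applyUpTo (suc n) f g = cong (_+_ (f (g 0))) (sumℤ-applyUpTo n f (g ∘ suc))

  ∑-cong : ∀ n {f g : ℕ → ℤ} → (∀ i → i < n → f i ≡ g i) → ∑ n f ≡ ∑ n g
  ∑-cong zero eq = refl
  ∑-cong (suc n) eq = cong₂ _+_ (eq 0 (s≤s ℕ.z≤n)) (∑-cong n (λ i i<n → eq (suc i) (s≤s i<n)))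

  ∑-zero : ∀ n → ∑ n (λ _ → + 0) ≡ + 0
  ∑-zero zero = refl
  ∑-zero (suc n) = trans (ℤₚ.+-identityˡ _) (∑-zero n)

  ∑-distrib-+ : ∀ n (f g : ℕ → ℤ) → ∑ n (λ i → f i + g i) ≡ ∑ n f + ∑ n g
  ∑-distrib-+ zero f g = refl
  ∑-distrib-+ (suc n) f g = trans (cong (_+_ (f 0 + g 0)) (∑-distrib-+ n (f ∘ suc) (g ∘ suc)))
    (solve 4 (λ a b c d → (a :+ b) :+ (c :+ d) := (a :+ c) :+ (b :+ d)) refl
      (f 0) (g 0) (∑ n (f ∘ suc)) (∑ n (g ∘ suc)))
    where open +-*-Solver

  ∑-*ˡ : ∀ n c (f : ℕ → ℤ) → ∑ n (λ i → c * f i) ≡ c * ∑ n f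
  ∑-*ˡ zero c f = sym (ℤₚ.*-zeroʳ c)
  ∑-*ˡ (suc n) c f =
    trans (cong (_+_ (c * f 0)) (∑-*ˡ n c (f ∘ suc))) (sym (ℤₚ.*-distribˡ-+ c (f 0) _))

  ∑-comm : ∀ m n (h : ℕ → ℕ → ℤ) → ∑ m (λ i → ∑ n (h i)) ≡ ∑ n (λ j → ∑ m (λ i → h i j))
  ∑-comm zero n h = sym (∑-zero n)
  ∑-comm (suc m) n h = trans (cong (_+_ (∑ n (h 0))) (∑-comm m n (h ∘ suc)))
    (sym (∑-distrib-+ n (h 0) (λ j → ∑ m (λ i → h (suc i) j))))

  ∑-+ : ∀ m n (f : ℕ → ℤ) → ∑ (m ℕ.+ n) f ≡ ∑ m f + ∑ n (λ i → f (m ℕ.+ i))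
  ∑-+ zero n f = sym (ℤₚ.+-identityˡ _)
  ∑-+ (suc m) n f = trans (cong (_+_ (f 0)) (∑-+ m n (f ∘ suc))) (sym (ℤₚ.+-assoc (f 0) _ _))

  ∑-snoc : ∀ n (f : ℕ → ℤ) → ∑ (suc n) f ≡ ∑ n f + f n
  ∑-snoc zero f = ℤₚ.+-comm (f 0) (+ 0)
  ∑-snoc (suc n) f = trans (cong (_+_ (f 0)) (∑-snoc n (f ∘ suc))) (sym (ℤₚ.+-assoc (f 0) _ _))

  ∑-reverse : ∀ n (f : ℕ → ℤ) → ∑ n f ≡ ∑ n (λ i → f (n ∸ suc i))
  ∑-reverse zero f = refl
  ∑-reverse (suc n) f =
    trans (∑-snoc n f) (trans (cong (_+ f n) (∑-reverse n f)) (ℤₚ.+-comm _ (f n)))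

  shift : Series → Series
  shift f i = f (suc i)

  ⊛-coeff : ∀ f g n → (f ⊛ g) n ≡ ∑ (suc n) (λ i → f i * g (n ∸ i))
  ⊛-coeff f g n = sumℤ-applyUpTo (suc n) (λ i → f i * g (n ∸ i)) (λ i → i)

  ⊛-coeff-zero : ∀ f g → (f ⊛ g) 0 ≡ f 0 * g 0
  ⊛-coeff-zero f g = trans (⊛-coeff f g 0) (ℤₚ.+-identityʳ _)

  ⊛-coeff-suc : ∀ f g n → (f ⊛ g) (suc n) ≡ f 0 * g (suc n) + (shift f ⊛ g) n
  ⊛-coeff-suc f g n = trans (⊛-coeff f g (suc n)) (cong (_+_ (f 0 * g (suc n))) (sym (⊛-coeff (shift f) g n)))

  ⊛-congʳ-≤ : ∀ f {g g′} n → (∀ m → m ≤ n → g m ≡ g′ m) → (f ⊛ g) n ≡ (f ⊛ g′) n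
  ⊛-congʳ-≤ f {g} {g′} n eq = begin
    (f ⊛ g) n                         ≡⟨ ⊛-coeff f g n ⟩
    ∑ (suc n) (λ i → f i * g (n ∸ i))  ≡⟨ ∑-cong (suc n) (λ i _ → cong (f i *_) (eq (n ∸ i) (ℕₚ.m∸n≤m n i))) ⟩
    ∑ (suc n) (λ i → f i * g′ (n ∸ i)) ≡⟨ ⊛-coeff f g′ n ⟨
    (f ⊛ g′) n                        ∎
    where open ≡-Reasoning

  ⊛-cong : ∀ {f f′ g g′} → f ≗ f′ → g ≗ g′ → f ⊛ g ≗ f′ ⊛ g′
  ⊛-cong {f} {f′} {g} {g′} f≗f′ g≗g′ n = begin
    (f ⊛ g) n                          ≡⟨ ⊛-coeff f g n ⟩
    ∑ (suc n) (λ i → f i * g (n ∸ i))   ≡⟨ ∑-cong (suc n) (λ i _ → cong₂ _*_ (f≗f′ i) (g≗g′ (n ∸ i))) ⟩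
    ∑ (suc n) (λ i → f′ i * g′ (n ∸ i)) ≡⟨ ⊛-coeff f′ g′ n ⟨
    (f′ ⊛ g′) n                        ∎
    where open ≡-Reasoning

  ⊛-comm : ∀ f g → f ⊛ g ≗ g ⊛ f
  ⊛-comm f g n = begin
    (f ⊛ g) n                                    ≡⟨ ⊛-coeff f g n ⟩
    ∑ (suc n) (λ i → f i * g (n ∸ i))             ≡⟨ ∑-reverse (suc n) (λ i → f i * g (n ∸ i)) ⟩
    ∑ (suc n) (λ i → f (n ∸ i) * g (n ∸ (n ∸ i))) ≡⟨ ∑-cong (suc n) swap ⟩
    ∑ (suc n) (λ i → g i * f (n ∸ i))             ≡⟨ ⊛-coeff g f n ⟨
    (g ⊛ f) n                                    ∎
    where
    open ≡-Reasoning
    swap : ∀ i → i < suc n → f (n ∸ i) * g (n ∸ (n ∸ i)) ≡ g i * f (n ∸ i)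
    swap i i<1+n = trans (cong (λ j → f (n ∸ i) * g j) (ℕₚ.m∸[m∸n]≡n (ℕₚ.≤-pred i<1+n)))
                         (ℤₚ.*-comm (f (n ∸ i)) (g i))

  ⊛-distribʳ-⊕ : ∀ f g h → (f ⊕ g) ⊛ h ≗ f ⊛ h ⊕ g ⊛ h
  ⊛-distribʳ-⊕ f g h n = begin
    ((f ⊕ g) ⊛ h) n
      ≡⟨ ⊛-coeff (f ⊕ g) h n ⟩
    ∑ (suc n) (λ i → (f i + g i) * h (n ∸ i))
      ≡⟨ ∑-cong (suc n) (λ i _ → ℤₚ.*-distribʳ-+ (h (n ∸ i)) (f i) (g i)) ⟩
    ∑ (suc n) (λ i → f i * h (n ∸ i) + g i * h (n ∸ i))
      ≡⟨ ∑-distrib-+ (suc n) (λ i → f i * h (n ∸ i)) (λ i → g i * h (n ∸ i)) ⟩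
    ∑ (suc n) (λ i → f i * h (n ∸ i)) + ∑ (suc n) (λ i → g i * h (n ∸ i))
      ≡⟨ cong₂ _+_ (⊛-coeff f h n) (⊛-coeff g h n) ⟨
    (f ⊛ h ⊕ g ⊛ h) n ∎
    where open ≡-Reasoning

  ⊛-distribˡ-⊕ : ∀ f g h → h ⊛ (f ⊕ g) ≗ h ⊛ f ⊕ h ⊛ g
  ⊛-distribˡ-⊕ f g h n = trans (⊛-comm h (f ⊕ g) n)
    (trans (⊛-distribʳ-⊕ f g h n) (cong₂ _+_ (⊛-comm f h n) (⊛-comm g h n)))

  ⊛-zeroˡ : ∀ f → 𝟘 ⊛ f ≗ 𝟘
  ⊛-zeroˡ f n = trans (⊛-coeff 𝟘 f n)
    (trans (∑-cong (suc n) (λ i _ → ℤₚ.*-zeroˡ (f (n ∸ i)))) (∑-zero (suc n)))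

  _•_ : ℤ → Series → Series
  (c • f) n = c * f n

  •-⊛ : ∀ c f g → (c • f) ⊛ g ≗ c • (f ⊛ g)
  •-⊛ c f g n = begin
    ((c • f) ⊛ g) n                         ≡⟨ ⊛-coeff (c • f) g n ⟩
    ∑ (suc n) (λ i → c * f i * g (n ∸ i))    ≡⟨ ∑-cong (suc n) (λ i _ → ℤₚ.*-assoc c (f i) (g (n ∸ i))) ⟩
    ∑ (suc n) (λ i → c * (f i * g (n ∸ i)))  ≡⟨ ∑-*ˡ (suc n) c (λ i → f i * g (n ∸ i)) ⟩
    c * ∑ (suc n) (λ i → f i * g (n ∸ i))    ≡⟨ cong (c *_) (⊛-coeff f g n) ⟨
    c * (f ⊛ g) n                           ∎
    where open ≡-Reasoning

  ⊛-assoc : ∀ f g h → (f ⊛ g) ⊛ h ≗ f ⊛ (g ⊛ h)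
  ⊛-assoc f g h zero = begin
    ((f ⊛ g) ⊛ h) 0     ≡⟨ ⊛-coeff-zero (f ⊛ g) h ⟩
    (f ⊛ g) 0 * h 0     ≡⟨ cong (_* h 0) (⊛-coeff-zero f g) ⟩
    f 0 * g 0 * h 0     ≡⟨ ℤₚ.*-assoc (f 0) (g 0) (h 0) ⟩
    f 0 * (g 0 * h 0)   ≡⟨ cong (f 0 *_) (⊛-coeff-zero g h) ⟨
    f 0 * (g ⊛ h) 0     ≡⟨ ⊛-coeff-zero f (g ⊛ h) ⟨
    (f ⊛ (g ⊛ h)) 0     ∎
    where open ≡-Reasoning
  ⊛-assoc f g h (suc n) = begin
    ((f ⊛ g) ⊛ h) (suc n)
      ≡⟨ ⊛-coeff-suc (f ⊛ g) h n ⟩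
    (f ⊛ g) 0 * h (suc n) + (shift (f ⊛ g) ⊛ h) n
      ≡⟨ cong₂ (λ a b → a * h (suc n) + b) (⊛-coeff-zero f g)
           (trans (⊛-cong {g = h} (⊛-coeff-suc f g) (λ _ → refl) n) (⊛-distribʳ-⊕ (f 0 • shift g) (shift f ⊛ g) h n)) ⟩
    f 0 * g 0 * h (suc n) + (((f 0 • shift g) ⊛ h) n + ((shift f ⊛ g) ⊛ h) n)
      ≡⟨ cong₂ (λ a b → f 0 * g 0 * h (suc n) + (a + b)) (•-⊛ (f 0) (shift g) h n) (⊛-assoc (shift f) g h n) ⟩
    f 0 * g 0 * h (suc n) + (f 0 * (shift g ⊛ h) n + (shift f ⊛ (g ⊛ h)) n)
      ≡⟨ solve 5 (λ a b c d e → a :* b :* c :+ (a :* d :+ e) := a :* (b :* c :+ d) :+ e) refl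
           (f 0) (g 0) (h (suc n)) ((shift g ⊛ h) n) ((shift f ⊛ (g ⊛ h)) n) ⟩
    f 0 * (g 0 * h (suc n) + (shift g ⊛ h) n) + (shift f ⊛ (g ⊛ h)) n
      ≡⟨ cong (λ a → f 0 * a + (shift f ⊛ (g ⊛ h)) n) (⊛-coeff-suc g h n) ⟨
    f 0 * (g ⊛ h) (suc n) + (shift f ⊛ (g ⊛ h)) n
      ≡⟨ ⊛-coeff-suc f (g ⊛ h) n ⟨
    (f ⊛ (g ⊛ h)) (suc n) ∎
    where
    open ≡-Reasoning
    open +-*-Solver

  ⊛-identityˡ : ∀ f → 𝟙 ⊛ f ≗ f
  ⊛-identityˡ f zero = trans (⊛-coeff-zero 𝟙 f) (ℤₚ.*-identityˡ (f 0))
  ⊛-identityˡ f (suc n) = begin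
    (𝟙 ⊛ f) (suc n)
      ≡⟨ ⊛-coeff-suc 𝟙 f n ⟩
    + 1 * f (suc n) + (shift 𝟙 ⊛ f) n
      ≡⟨ cong₂ _+_ (ℤₚ.*-identityˡ (f (suc n))) (⊛-cong {shift 𝟙} {𝟘} {f} (λ _ → refl) (λ _ → refl) n) ⟩
    f (suc n) + (𝟘 ⊛ f) n
      ≡⟨ cong (_+_ (f (suc n))) (⊛-zeroˡ f n) ⟩
    f (suc n) + + 0
      ≡⟨ ℤₚ.+-identityʳ _ ⟩
    f (suc n) ∎
    where open ≡-Reasoning

  X⊛-zero : ∀ f → (X ⊛ f) 0 ≡ + 0
  X⊛-zero f = ⊛-coeff-zero X f

  X⊛-suc : ∀ f n → (X ⊛ f) (suc n) ≡ f n
  X⊛-suc f n = begin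
    (X ⊛ f) (suc n)       ≡⟨ ⊛-coeff-suc X f n ⟩
    + 0 + (shift X ⊛ f) n ≡⟨ ℤₚ.+-identityˡ _ ⟩
    (shift X ⊛ f) n       ≡⟨ ⊛-cong {shift X} {𝟙} {f} (λ { zero → refl ; (suc _) → refl }) (λ _ → refl) n ⟩
    (𝟙 ⊛ f) n             ≡⟨ ⊛-identityˡ f n ⟩
    f n                   ∎
    where open ≡-Reasoning

  X²⊛-zero : ∀ f → (X ⊛ X ⊛ f) 0 ≡ + 0
  X²⊛-zero f = trans (⊛-coeff-zero (X ⊛ X) f) (trans (cong (_* f 0) (X⊛-zero X)) (ℤₚ.*-zeroˡ (f 0)))

  X²⊛-suc-suc : ∀ f n → (X ⊛ X ⊛ f) (suc (suc n)) ≡ f n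
  X²⊛-suc-suc f n = trans (⊛-assoc X X f (suc (suc n))) (trans (X⊛-suc (X ⊛ f) (suc n)) (X⊛-suc f n))

  ≗𝟙⊕X²⊛ : ∀ {y} f → y 0 ≡ + 1 → y 1 ≡ + 0 → (∀ n → y (suc (suc n)) ≡ f n) → y ≗ 𝟙 ⊕ X ⊛ X ⊛ f
  ≗𝟙⊕X²⊛ f y₀ y₁ y₂₊ zero = trans y₀ (sym (cong (_+_ (+ 1)) (X²⊛-zero f)))
  ≗𝟙⊕X²⊛ f y₀ y₁ y₂₊ (suc zero) =
    trans y₁ (sym (trans (ℤₚ.+-identityˡ _) (trans (⊛-assoc X X f 1) (trans (X⊛-suc (X ⊛ f) 0) (X⊛-zero f)))))
  ≗𝟙⊕X²⊛ f y₀ y₁ y₂₊ (suc (suc n)) = trans (y₂₊ n) (sym (trans (ℤₚ.+-identityˡ _) (X²⊛-suc-suc f n)))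

  negate : Series → Series
  negate f n = - f n

  seriesRing : CommutativeRing 0ℓ 0ℓ
  seriesRing = record
    { Carrier = Series ; _≈_ = _≗_ ; _+_ = _⊕_ ; _*_ = _⊛_ ; -_ = negate ; 0# = 𝟘 ; 1# = 𝟙
    ; isCommutativeRing = record
       { isRing = record
          { +-isAbelianGroup = record
             { isGroup = record
                { isMonoid = record
                   { isSemigroup = record
                      { isMagma = record
                         { isEquivalence = record
                             { refl = λ _ → refl ; sym = λ p n → sym (p n) ; trans = λ p q n → trans (p n) (q n) }
                         ; ∙-cong = λ p q n → cong₂ _+_ (p n) (q n) }
                      ; assoc = λ f g h n → ℤₚ.+-assoc (f n) (g n) (h n) }
                   ; identity = (λ f n → ℤₚ.+-identityˡ (f n)) , (λ f n → ℤₚ.+-identityʳ (f n)) }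
                ; inverse = (λ f n → ℤₚ.+-inverseˡ (f n)) , (λ f n → ℤₚ.+-inverseʳ (f n))
                ; ⁻¹-cong = λ p n → cong -_ (p n) }
             ; comm = λ f g n → ℤₚ.+-comm (f n) (g n) }
          ; *-cong = ⊛-cong
          ; *-assoc = ⊛-assoc
          ; *-identity = ⊛-identityˡ , (λ f n → trans (⊛-comm f 𝟙 n) (⊛-identityˡ f n))
          ; distrib = (λ f g h → ⊛-distribˡ-⊕ g h f) , (λ f g h → ⊛-distribʳ-⊕ g h f) }
       ; *-comm = ⊛-comm } }

  constant : ℤ → Series
  constant c zero = c
  constant c (suc n) = + 0

  -- 0 and 1 go to 𝟘 and 𝟙 themselves, so that the solver's `con (+ 1)` is definitionally 𝟙.
  ⟦_⟧ᶜ : ℤ → Series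
  ⟦ + 0 ⟧ᶜ = 𝟘
  ⟦ + 1 ⟧ᶜ = 𝟙
  ⟦ c ⟧ᶜ = constant c

  ⟦⟧ᶜ≗constant : ∀ c → ⟦ c ⟧ᶜ ≗ constant c
  ⟦⟧ᶜ≗constant (+ 0) zero = refl
  ⟦⟧ᶜ≗constant (+ 0) (suc n) = refl
  ⟦⟧ᶜ≗constant (+ 1) zero = refl
  ⟦⟧ᶜ≗constant (+ 1) (suc n) = refl
  ⟦⟧ᶜ≗constant (+ suc (suc m)) n = refl
  ⟦⟧ᶜ≗constant ℤ.-[1+ m ] n = refl

  constant-+ : ∀ a b → constant (a + b) ≗ constant a ⊕ constant b
  constant-+ a b zero = refl
  constant-+ a b (suc n) = refl

  constant-* : ∀ a b → constant (a * b) ≗ constant a ⊛ constant b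
  constant-* a b zero = sym (⊛-coeff-zero (constant a) (constant b))
  constant-* a b (suc n) = sym (begin
    (constant a ⊛ constant b) (suc n)            ≡⟨ ⊛-coeff-suc (constant a) (constant b) n ⟩
    a * + 0 + (shift (constant a) ⊛ constant b) n ≡⟨ cong₂ _+_ (ℤₚ.*-zeroʳ a) (⊛-zeroˡ (constant b) n) ⟩
    + 0                                          ∎)
    where open ≡-Reasoning

  constant-neg : ∀ a → constant (- a) ≗ negate (constant a)
  constant-neg a zero = refl
  constant-neg a (suc n) = refl

  constant-homomorphism : CommutativeRing.rawRing ℤₚ.+-*-commutativeRing
    -Raw-AlmostCommutative⟶ fromCommutativeRing seriesRing
  constant-homomorphism = record
    { ⟦_⟧ = ⟦_⟧ᶜ
    ; +-homo = λ a b n → trans (⟦⟧ᶜ≗constant (a + b) n)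
        (trans (constant-+ a b n) (sym (cong₂ _+_ (⟦⟧ᶜ≗constant a n) (⟦⟧ᶜ≗constant b n))))
    ; *-homo = λ a b n → trans (⟦⟧ᶜ≗constant (a * b) n)
        (trans (constant-* a b n) (sym (⊛-cong (⟦⟧ᶜ≗constant a) (⟦⟧ᶜ≗constant b) n)))
    ; -‿homo = λ a n → trans (⟦⟧ᶜ≗constant (- a) n)
        (trans (constant-neg a n) (sym (cong -_ (⟦⟧ᶜ≗constant a n))))
    ; 0-homo = λ _ → refl
    ; 1-homo = λ _ → refl }

  ⟦⟧ᶜ-≟ : ∀ a b → Maybe (⟦ a ⟧ᶜ ≗ ⟦ b ⟧ᶜ)
  ⟦⟧ᶜ-≟ a b with a ℤ.≟ b
  ... | yes refl = just (λ _ → refl)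
  ... | no _ = nothing

  open CommutativeRing seriesRing public using ()
    renaming (+-cong to ⊕-cong; +-congˡ to ⊕-congˡ; +-congʳ to ⊕-congʳ; *-congˡ to ⊛-congˡ; *-congʳ to ⊛-congʳ)
  module ≗-Reasoning = Relation.Binary.Reasoning.Setoid (CommutativeRing.setoid seriesRing)

  open RingSolver (CommutativeRing.rawRing ℤₚ.+-*-commutativeRing) (fromCommutativeRing seriesRing)
    constant-homomorphism ⟦⟧ᶜ-≟ public

  pow-coeff-< : ∀ g → g 0 ≡ + 0 → ∀ m n → n < m → pow g m n ≡ + 0
  pow-coeff-< g g₀ (suc m) zero _ = trans (⊛-coeff-zero g (pow g m)) (cong (_* pow g m 0) g₀)
  pow-coeff-< g g₀ (suc m) (suc n) (s≤s n<m) = begin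
    (g ⊛ pow g m) (suc n)
      ≡⟨ ⊛-coeff-suc g (pow g m) n ⟩
    g 0 * pow g m (suc n) + (shift g ⊛ pow g m) n
      ≡⟨ cong₂ _+_ (cong (_* pow g m (suc n)) g₀) (⊛-coeff (shift g) (pow g m) n) ⟩
    + 0 + ∑ (suc n) (λ i → g (suc i) * pow g m (n ∸ i))
      ≡⟨ ℤₚ.+-identityˡ _ ⟩
    ∑ (suc n) (λ i → g (suc i) * pow g m (n ∸ i))
      ≡⟨ ∑-cong (suc n) (λ i _ → low i) ⟩
    ∑ (suc n) (λ _ → + 0)
      ≡⟨ ∑-zero (suc n) ⟩
    + 0 ∎
    where
    open ≡-Reasoning
    low : ∀ i → g (suc i) * pow g m (n ∸ i) ≡ + 0
    low i = trans (cong (g (suc i) *_) (pow-coeff-< g g₀ m (n ∸ i) (ℕₚ.≤-<-trans (ℕₚ.m∸n≤m n i) n<m)))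
                  (ℤₚ.*-zeroʳ (g (suc i)))

  ∑-⊛ : ∀ N a (P : ℕ → Series) n → ∑ N (λ m → (a ⊛ P m) n) ≡ (a ⊛ (λ t → ∑ N (λ m → P m t))) n
  ∑-⊛ N a P n = begin
    ∑ N (λ m → (a ⊛ P m) n)                           ≡⟨ ∑-cong N (λ m _ → ⊛-coeff a (P m) n) ⟩
    ∑ N (λ m → ∑ (suc n) (λ i → a i * P m (n ∸ i)))    ≡⟨ ∑-comm (suc n) N (λ i m → a i * P m (n ∸ i)) ⟨
    ∑ (suc n) (λ i → ∑ N (λ m → a i * P m (n ∸ i)))
      ≡⟨ ∑-cong (suc n) (λ i _ → ∑-*ˡ N (a i) (λ m → P m (n ∸ i))) ⟩
    ∑ (suc n) (λ i → a i * ∑ N (λ m → P m (n ∸ i)))    ≡⟨ ⊛-coeff a (λ t → ∑ N (λ m → P m t)) n ⟨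
    (a ⊛ (λ t → ∑ N (λ m → P m t))) n                 ∎
    where open ≡-Reasoning

  -- With g = 1 - f, inv f is the geometric series ∑ g^m truncated at m ≤ n in degree n;
  -- truncating later changes nothing since g^m has no terms below degree m.
  module _ (f : Series) (f₀ : f 0 ≡ + 1) where

    private
      g : Series
      g = 𝟙 ⊖ f

      g₀ : g 0 ≡ + 0
      g₀ = cong (_-_ (+ 1)) f₀

    inv-coeff-≤ : ∀ N n → n ≤ N → ∑ (suc N) (λ m → pow g m n) ≡ inv f n
    inv-coeff-≤ N n n≤N = begin
      ∑ (suc N) (λ m → pow g m n)
        ≡⟨ cong (λ k → ∑ (suc k) (λ m → pow g m n)) (ℕₚ.m+[n∸m]≡n n≤N) ⟨
      ∑ (suc n ℕ.+ (N ∸ n)) (λ m → pow g m n)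
        ≡⟨ ∑-+ (suc n) (N ∸ n) (λ m → pow g m n) ⟩
      ∑ (suc n) (λ m → pow g m n) + ∑ (N ∸ n) (λ i → pow g (suc n ℕ.+ i) n)
        ≡⟨ cong (_+_ (∑ (suc n) (λ m → pow g m n))) (trans (∑-cong (N ∸ n) (λ i _ → high i)) (∑-zero (N ∸ n))) ⟩
      ∑ (suc n) (λ m → pow g m n) + + 0
        ≡⟨ ℤₚ.+-identityʳ _ ⟩
      ∑ (suc n) (λ m → pow g m n)
        ≡⟨ sumℤ-applyUpTo (suc n) (λ m → pow g m n) (λ m → m) ⟨
      inv f n ∎
      where
      open ≡-Reasoning
      high : ∀ i → pow g (suc n ℕ.+ i) n ≡ + 0
      high i = pow-coeff-< g g₀ (suc n ℕ.+ i) n (s≤s (ℕₚ.m≤m+n n i))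

    inv-fixpoint : inv f ≗ 𝟙 ⊕ g ⊛ inv f
    inv-fixpoint zero = trans (sumℤ-applyUpTo 1 (λ m → pow g m 0) (λ m → m))
      (sym (cong (_+_ (+ 1)) (trans (⊛-coeff-zero g (inv f)) (cong (_* inv f 0) g₀))))
    inv-fixpoint (suc n) = begin
      inv f (suc n)
        ≡⟨ sumℤ-applyUpTo (suc (suc n)) (λ m → pow g m (suc n)) (λ m → m) ⟩
      + 0 + ∑ (suc n) (λ m → (g ⊛ pow g m) (suc n))
        ≡⟨ cong (_+_ (+ 0)) (∑-cong (suc n) (λ m _ → g⊛-suc (pow g m))) ⟩
      + 0 + ∑ (suc n) (λ m → (shift g ⊛ pow g m) n)
        ≡⟨ cong (_+_ (+ 0)) (∑-⊛ (suc n) (shift g) (pow g) n) ⟩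
      + 0 + (shift g ⊛ (λ t → ∑ (suc n) (λ m → pow g m t))) n
        ≡⟨ cong (_+_ (+ 0)) (⊛-congʳ-≤ (shift g) n (inv-coeff-≤ n)) ⟩
      + 0 + (shift g ⊛ inv f) n
        ≡⟨ cong (_+_ (+ 0)) (g⊛-suc (inv f)) ⟨
      (𝟙 ⊕ g ⊛ inv f) (suc n) ∎
      where
      open ≡-Reasoning
      g⊛-suc : ∀ h → (g ⊛ h) (suc n) ≡ (shift g ⊛ h) n
      g⊛-suc h = trans (⊛-coeff-suc g h n)
        (trans (cong (λ c → c * h (suc n) + (shift g ⊛ h) n) g₀) (ℤₚ.+-identityˡ _))

    ⊛-inverseʳ : f ⊛ inv f ≗ 𝟙
    ⊛-inverseʳ = begin
      f ⊛ inv f                      ≈⟨ ⊛-cong f≗𝟙⊖g (λ _ → refl) ⟩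
      (𝟙 ⊖ g) ⊛ inv f                ≈⟨ solve 2 (λ g i → (con (+ 1) :- g) :* i := i :- g :* i) (λ _ → refl) g (inv f) ⟩
      inv f ⊖ g ⊛ inv f              ≈⟨ ⊕-congʳ inv-fixpoint ⟩
      (𝟙 ⊕ g ⊛ inv f) ⊖ g ⊛ inv f
        ≈⟨ solve 2 (λ g i → (con (+ 1) :+ g :* i) :- g :* i := con (+ 1)) (λ _ → refl) g (inv f) ⟩
      𝟙 ∎
      where
      open ≗-Reasoning
      f≗𝟙⊖g : f ≗ 𝟙 ⊖ g
      f≗𝟙⊖g n = +-*-Solver.solve 2 (λ a b → a +-*-Solver.:= b +-*-Solver.:- (b +-*-Solver.:- a)) refl (f n) (𝟙 n)

  ⊘-unique : ∀ {d y m} → d 0 ≡ + 1 → d ⊛ y ≗ m → y ≗ m ⊘ d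
  ⊘-unique {d} {y} {m} d₀ dy≗m = begin
    y                   ≈⟨ solve 1 (λ y → y := y :* con (+ 1)) (λ _ → refl) y ⟩
    y ⊛ 𝟙               ≈⟨ ⊛-congˡ {y} (⊛-inverseʳ d d₀) ⟨
    y ⊛ (d ⊛ inv d)     ≈⟨ solve 3 (λ y d i → y :* (d :* i) := (d :* y) :* i) (λ _ → refl) y d (inv d) ⟩
    (d ⊛ y) ⊛ inv d     ≈⟨ ⊛-congʳ {inv d} dy≗m ⟩
    m ⊛ inv d           ∎
    where open ≗-Reasoning

  F-unique : (h : ℕ → Series) → h 0 ≗ 𝟘 → h 1 ≗ 𝟙 →
    (∀ r → h (suc (suc r)) ≗ 𝟙 ⊕ X ⊛ X ⊛ (h (suc r) ⊕ h r ⊛ (h (suc (suc r)) ⊖ 𝟙))) →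
    ∀ r → h r ≗ F r
  F-unique h h₀ h₁ rec r = proj₁ (consecutive r)
    where
    open ≗-Reasoning

    next : ∀ r → h r ≗ F r → h (suc r) ≗ F (suc r) → h (suc (suc r)) ≗ F (suc (suc r))
    next r hᵣ hᵣ₊₁ = begin
      h₂
        ≈⟨ solve 1 (λ h → h := con (+ 1) :+ (h :- con (+ 1))) (λ _ → refl) h₂ ⟩
      𝟙 ⊕ (h₂ ⊖ 𝟙)
        ≈⟨ ⊕-congˡ {𝟙} (⊘-unique {𝟙 ⊖ X ⊛ X ⊛ B} (cong (_-_ (+ 1)) (X²⊛-zero B)) D⊛[h₂-1]) ⟩
      𝟙 ⊕ (X ⊛ X ⊛ A) ⊘ (𝟙 ⊖ X ⊛ X ⊛ B) ∎
      where
      A = F (suc r)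
      B = F r
      Z = X ⊛ X
      h₂ = h (suc (suc r))
      D⊛[h₂-1] : (𝟙 ⊖ Z ⊛ B) ⊛ (h₂ ⊖ 𝟙) ≗ Z ⊛ A
      D⊛[h₂-1] = begin
        (𝟙 ⊖ Z ⊛ B) ⊛ (h₂ ⊖ 𝟙)
          ≈⟨ solve 3 (λ z b h → (con (+ 1) :- z :* b) :* (h :- con (+ 1)) := (h :- con (+ 1)) :- z :* b :* (h :- con (+ 1)))
               (λ _ → refl) Z B h₂ ⟩
        (h₂ ⊖ 𝟙) ⊖ Z ⊛ B ⊛ (h₂ ⊖ 𝟙)
          ≈⟨ ⊕-congʳ (⊕-congʳ (λ n → trans (rec r n)
               (⊕-congˡ {𝟙} (⊛-congˡ {Z} (⊕-cong hᵣ₊₁ (⊛-congʳ {h₂ ⊖ 𝟙} hᵣ))) n))) ⟩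
        ((𝟙 ⊕ Z ⊛ (A ⊕ B ⊛ (h₂ ⊖ 𝟙))) ⊖ 𝟙) ⊖ Z ⊛ B ⊛ (h₂ ⊖ 𝟙)
          ≈⟨ solve 4 (λ z a b h → ((con (+ 1) :+ z :* (a :+ b :* (h :- con (+ 1)))) :- con (+ 1))
                                  :- z :* b :* (h :- con (+ 1)) := z :* a)
               (λ _ → refl) Z A B h₂ ⟩
        Z ⊛ A ∎

    consecutive : ∀ r → h r ≗ F r × h (suc r) ≗ F (suc r)
    consecutive zero = h₀ , h₁
    consecutive (suc r) with consecutive r
    ... | hᵣ , hᵣ₊₁ = hᵣ₊₁ , next r hᵣ hᵣ₊₁

  RHS-factor : ∀ q {y} → y ≗ 𝟙 ⊕ X ⊛ X ⊛ (y ⊕ F q ⊛ (y ⊖ 𝟙)) → RHS (suc (suc (suc q))) ≗ (𝟙 ⊕ X) ⊛ y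
  RHS-factor q {y} rec n = sym (factor n)
    where
    open ≗-Reasoning
    B = F q
    Z = X ⊛ X
    Den = 𝟙 ⊖ Z ⊖ Z ⊛ B
    Den₀ : Den 0 ≡ + 1
    Den₀ = cong₂ (λ u v → + 1 - u - v) (X⊛-zero X) (X²⊛-zero B)
    Den⊛[1+X][y-1] : Den ⊛ ((𝟙 ⊕ X) ⊛ (y ⊖ 𝟙)) ≗ Z ⊛ (𝟙 ⊕ X)
    Den⊛[1+X][y-1] = begin
      Den ⊛ ((𝟙 ⊕ X) ⊛ (y ⊖ 𝟙))
        ≈⟨ solve 4 (λ z b x y → (con (+ 1) :- z :- z :* b) :* ((con (+ 1) :+ x) :* (y :- con (+ 1)))
                              := (con (+ 1) :+ x) :* ((y :- con (+ 1)) :- z :* (y :- con (+ 1)) :- z :* b :* (y :- con (+ 1))))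
             (λ _ → refl) Z B X y ⟩
      (𝟙 ⊕ X) ⊛ ((y ⊖ 𝟙) ⊖ Z ⊛ (y ⊖ 𝟙) ⊖ Z ⊛ B ⊛ (y ⊖ 𝟙))
        ≈⟨ ⊛-congˡ {𝟙 ⊕ X} (⊕-congʳ (⊕-congʳ (⊕-congʳ rec))) ⟩
      (𝟙 ⊕ X) ⊛ ((𝟙 ⊕ Z ⊛ (y ⊕ B ⊛ (y ⊖ 𝟙)) ⊖ 𝟙) ⊖ Z ⊛ (y ⊖ 𝟙) ⊖ Z ⊛ B ⊛ (y ⊖ 𝟙))
        ≈⟨ solve 4 (λ z b x y → (con (+ 1) :+ x) :* ((con (+ 1) :+ z :* (y :+ b :* (y :- con (+ 1))) :- con (+ 1))
                                                     :- z :* (y :- con (+ 1)) :- z :* b :* (y :- con (+ 1)))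
                              := z :* (con (+ 1) :+ x))
             (λ _ → refl) Z B X y ⟩
      Z ⊛ (𝟙 ⊕ X) ∎
    factor : (𝟙 ⊕ X) ⊛ y ≗ 𝟙 ⊕ X ⊕ (Z ⊛ (𝟙 ⊕ X)) ⊘ Den
    factor = begin
      (𝟙 ⊕ X) ⊛ y
        ≈⟨ solve 2 (λ x y → (con (+ 1) :+ x) :* y := con (+ 1) :+ x :+ (con (+ 1) :+ x) :* (y :- con (+ 1)))
             (λ _ → refl) X y ⟩
      𝟙 ⊕ X ⊕ (𝟙 ⊕ X) ⊛ (y ⊖ 𝟙)
        ≈⟨ ⊕-congˡ {𝟙 ⊕ X} (⊘-unique {Den} Den₀ Den⊛[1+X][y-1]) ⟩
      𝟙 ⊕ X ⊕ (Z ⊛ (𝟙 ⊕ X)) ⊘ Den ∎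

  ⊛-⊖𝟙-coeff : ∀ b c t → c 0 ≡ + 1 → (b ⊛ (c ⊖ 𝟙)) t ≡ ∑ t (λ i → b i * c (t ∸ i))
  ⊛-⊖𝟙-coeff b c t c₀ = begin
    (b ⊛ (c ⊖ 𝟙)) t
      ≡⟨ ⊛-coeff b (c ⊖ 𝟙) t ⟩
    ∑ (suc t) (λ i → b i * (c (t ∸ i) - 𝟙 (t ∸ i)))
      ≡⟨ ∑-snoc t (λ i → b i * (c (t ∸ i) - 𝟙 (t ∸ i))) ⟩
    ∑ t (λ i → b i * (c (t ∸ i) - 𝟙 (t ∸ i))) + b t * (c (t ∸ t) - 𝟙 (t ∸ t))
      ≡⟨ cong₂ _+_ (∑-cong t (λ i i<t → cong (λ u → b i * (c (t ∸ i) - u)) (𝟙-pos (ℕₚ.m<n⇒0<n∸m i<t))))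
                   (trans (cong (λ u → b t * (c u - 𝟙 u)) (ℕₚ.n∸n≡0 t))
                          (trans (cong (λ u → b t * (u - + 1)) c₀) (ℤₚ.*-zeroʳ (b t)))) ⟩
    ∑ t (λ i → b i * (c (t ∸ i) - + 0)) + + 0
      ≡⟨ trans (ℤₚ.+-identityʳ _) (∑-cong t (λ i _ → cong (b i *_) (ℤₚ.+-identityʳ (c (t ∸ i))))) ⟩
    ∑ t (λ i → b i * c (t ∸ i)) ∎
    where
    open ≡-Reasoning
    𝟙-pos : ∀ {n} → 0 < n → 𝟙 n ≡ + 0
    𝟙-pos {suc n} _ = refl

open import Data.Nat as ℕ using (ℕ; zero; suc; _+_; _∸_; _<_; _≤_; _≥_; z≤n; s≤s; _≤?_)
import Data.Nat.Properties as ℕₚ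
open import Data.Nat.Divisibility using (_∣?_; divides; ∣m∣n⇒∣m+n; ∣m+n∣m⇒∣n; ∣1⇒≡1; ∣-refl)
open import Data.Nat.Induction using (<-rec)
import Data.Integer as ℤ
import Data.Integer.Properties as ℤₚ
open import Data.List using (List; []; _∷_; _++_; [_]; map; upTo; applyUpTo; length; take; concatMap)
import Data.List.Properties as Listₚ
open import Data.List.Membership.Propositional using (_∈_; find; lose)
open import Data.List.Membership.Propositional.Properties
  using (∈-map⁺; ∈-map⁻; ∈-++⁺ˡ; ∈-++⁺ʳ; ∈-++⁻; ∈-∃++; ∈-upTo⁺; ∈-upTo⁻;
         ∈-concatMap⁺; ∈-concatMap⁻)
open import Data.List.Relation.Unary.Any using (here; there)
open import Data.List.Relation.Unary.All as All using (All; []; _∷_)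
import Data.List.Relation.Unary.All.Properties as Allₚ
open import Data.List.Relation.Unary.AllPairs as AllPairs using (AllPairs; []; _∷_)
import Data.List.Relation.Unary.AllPairs.Properties as AllPairsₚ
open import Data.List.Relation.Unary.Unique.Propositional using (Unique)
import Data.List.Relation.Unary.Unique.Propositional.Properties as Uniqueₚ
open import Data.List.Relation.Binary.Pointwise as Pointwise using (Pointwise; []; _∷_)
open import Data.List.Relation.Binary.Sublist.Propositional
  using (_⊆_; []; _∷_; _∷ʳ_; ⊆-refl; ⊆-trans; minimum; from∈)
import Data.List.Relation.Binary.Sublist.Propositional.Properties as Sublistₚ
open import Data.List.Relation.Binary.Permutation.Propositional
  using (_↭_; ↭-refl; ↭-sym; ↭-trans; ↭-reflexive; ↭⇒↭ₛ)
import Data.List.Relation.Binary.Permutation.Propositional.Properties as Permₚ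
import Data.List.Relation.Binary.Permutation.Setoid.Properties as PermSetoidₚ
open import Data.Product using (_×_; _,_; ∃; ∃₂; proj₁; proj₂)
open import Data.Sum using (_⊎_; inj₁; inj₂)
open import Data.Empty using (⊥; ⊥-elim)
open import Data.Unit using (tt)
open import Function using (_∘_; _⇔_; mk⇔; Equivalence)
open import Relation.Nullary using (¬_; yes; no)
open import Relation.Binary.Definitions using (tri<; tri≈; tri>)
open import Relation.Binary.PropositionalEquality
  using (_≡_; _≢_; _≗_; refl; sym; trans; cong; cong₂; subst; subst₂; setoid; module ≡-Reasoning)

Even-2+ : ∀ {n} → Even n → Even (2 + n)
Even-2+ = ∣m∣n⇒∣m+n ∣-refl

Even-2+⁻ : ∀ {n} → Even (2 + n) → Even n
Even-2+⁻ e = ∣m+n∣m⇒∣n e ∣-refl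

Even-+ : ∀ {m n} → Even m → Even n → Even (m + n)
Even-+ = ∣m∣n⇒∣m+n

Even-+⁻ : ∀ {m n} → Even m → Even (m + n) → Even n
Even-+⁻ e e′ = ∣m+n∣m⇒∣n e′ e

Even⇒Odd-suc : ∀ {n} → Even n → Odd (suc n)
Even⇒Odd-suc {n} e e′ with ∣1⇒≡1 (∣m+n∣m⇒∣n (subst Even (ℕₚ.+-comm 1 n) e′) e)
... | ()

Even⊎Even-suc : ∀ n → Even n ⊎ Even (suc n)
Even⊎Even-suc zero = inj₁ (divides 0 refl)
Even⊎Even-suc (suc n) with Even⊎Even-suc n
... | inj₁ e = inj₂ (Even-2+ e)
... | inj₂ e = inj₁ e

Odd⇒Even-suc : ∀ {n} → Odd n → Even (suc n)
Odd⇒Even-suc {n} o with Even⊎Even-suc n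
... | inj₁ e = ⊥-elim (o e)
... | inj₂ e = e

Odd-suc⇒Even : ∀ {n} → Odd (suc n) → Even n
Odd-suc⇒Even {n} o with Even⊎Even-suc n
... | inj₁ e = e
... | inj₂ e = ⊥-elim (o e)

Even? : ∀ n → Even n ⊎ Odd n
Even? n with 2 ∣? n
... | yes e = inj₁ e
... | no o = inj₂ o

oneTo-snoc : ∀ n → oneTo (suc n) ≡ oneTo n ++ [ suc n ]
oneTo-snoc n = trans (cong (map suc) (sym (Listₚ.applyUpTo-∷ʳ (λ i → i) n))) (Listₚ.map-++ suc (upTo n) [ n ])

oneTo-+ : ∀ j m → oneTo (j + m) ≡ oneTo j ++ map (j +_) (oneTo m)
oneTo-+ j zero = trans (cong oneTo (ℕₚ.+-identityʳ j)) (sym (Listₚ.++-identityʳ (oneTo j)))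
oneTo-+ j (suc m) = begin
  oneTo (j + suc m)
    ≡⟨ cong oneTo (ℕₚ.+-suc j m) ⟩
  oneTo (suc (j + m))
    ≡⟨ oneTo-snoc (j + m) ⟩
  oneTo (j + m) ++ [ suc (j + m) ]
    ≡⟨ cong (_++ [ suc (j + m) ]) (oneTo-+ j m) ⟩
  (oneTo j ++ map (j +_) (oneTo m)) ++ [ suc (j + m) ]
    ≡⟨ Listₚ.++-assoc (oneTo j) _ _ ⟩
  oneTo j ++ (map (j +_) (oneTo m) ++ [ suc (j + m) ])
    ≡⟨ cong (λ x → oneTo j ++ (map (j +_) (oneTo m) ++ [ x ])) (ℕₚ.+-suc j m) ⟨
  oneTo j ++ (map (j +_) (oneTo m) ++ map (j +_) [ suc m ])
    ≡⟨ cong (oneTo j ++_) (Listₚ.map-++ (j +_) (oneTo m) [ suc m ]) ⟨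
  oneTo j ++ map (j +_) (oneTo m ++ [ suc m ])
    ≡⟨ cong (λ xs → oneTo j ++ map (j +_) xs) (oneTo-snoc m) ⟨
  oneTo j ++ map (j +_) (oneTo (suc m)) ∎
  where open ≡-Reasoning

length-oneTo : ∀ n → length (oneTo n) ≡ n
length-oneTo n = trans (Listₚ.length-map suc (upTo n)) (Listₚ.length-applyUpTo (λ i → i) n)

∈-oneTo⁻ : ∀ {n x} → x ∈ oneTo n → 1 ≤ x × x ≤ n
∈-oneTo⁻ x∈ with ∈-map⁻ suc x∈
... | y , y∈ , refl = s≤s z≤n , ∈-upTo⁻ y∈

∈-oneTo⁺ : ∀ {n x} → 1 ≤ x → x ≤ n → x ∈ oneTo n
∈-oneTo⁺ {x = suc x} _ x≤n = ∈-map⁺ suc (∈-upTo⁺ x≤n)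

Unique-oneTo : ∀ n → Unique (oneTo n)
Unique-oneTo n = Uniqueₚ.map⁺ ℕₚ.suc-injective (Uniqueₚ.upTo⁺ n)

Increasing : List ℕ → Set
Increasing = AllPairs _<_

upTo-increasing : ∀ n → Increasing (upTo n)
upTo-increasing n = AllPairsₚ.applyUpTo⁺₁ (λ i → i) n (λ i<j _ → i<j)

oneTo-increasing : ∀ n → Increasing (oneTo n)
oneTo-increasing n = AllPairsₚ.map⁺ (AllPairs.map s≤s (upTo-increasing n))

module _ {n π} (π↭ : π ↭ oneTo n) where

  ↭oneTo⇒Unique : Unique π
  ↭oneTo⇒Unique = PermSetoidₚ.Unique-resp-↭ (setoid ℕ) (↭⇒↭ₛ (↭-sym π↭)) (Unique-oneTo n)

  ↭oneTo⇒bounded : All (λ x → 1 ≤ x × x ≤ n) π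
  ↭oneTo⇒bounded = All.tabulate (λ x∈ → ∈-oneTo⁻ (Permₚ.∈-resp-↭ π↭ x∈))

  ↭oneTo⇒All< : All (_< suc n) π
  ↭oneTo⇒All< = All.map (s≤s ∘ proj₂) ↭oneTo⇒bounded

  ↭oneTo⇒length : length π ≡ n
  ↭oneTo⇒length = trans (Permₚ.↭-length π↭) (length-oneTo n)

↭oneTo⇒max∈ : ∀ {n π} → π ↭ oneTo (suc n) → suc n ∈ π
↭oneTo⇒max∈ π↭ = Permₚ.∈-resp-↭ (↭-sym π↭) (∈-oneTo⁺ (s≤s z≤n) ℕₚ.≤-refl)

↭oneTo-remove-max : ∀ {N} xs ys → xs ++ suc N ∷ ys ↭ oneTo (suc N) → xs ++ ys ↭ oneTo N
↭oneTo-remove-max {N} xs ys p = ↭-trans (Permₚ.drop-mid xs (oneTo N) (↭-trans p (↭-reflexive (oneTo-snoc N))))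
  (↭-reflexive (Listₚ.++-identityʳ (oneTo N)))

++[x]-cancel-↭ : ∀ xs ys (x : ℕ) → xs ++ [ x ] ↭ ys ++ [ x ] → xs ↭ ys
++[x]-cancel-↭ xs ys x p = subst₂ _↭_ (Listₚ.++-identityʳ xs) (Listₚ.++-identityʳ ys) (Permₚ.drop-mid xs ys p)

↭oneTo-snoc⁺ : ∀ {n π} → π ↭ oneTo n → π ++ [ suc n ] ↭ oneTo (suc n)
↭oneTo-snoc⁺ {n} π↭ = ↭-trans (Permₚ.++⁺ʳ [ suc n ] π↭) (↭-reflexive (sym (oneTo-snoc n)))

↭oneTo-snoc⁻ : ∀ {n} π → π ++ [ suc n ] ↭ oneTo (suc n) → π ↭ oneTo n
↭oneTo-snoc⁻ {n} π π↭ = ++[x]-cancel-↭ π (oneTo n) (suc n) (↭-trans π↭ (↭-reflexive (oneTo-snoc n)))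

⊆-insert : ∀ (xs : List ℕ) {ys} y → xs ++ ys ⊆ xs ++ y ∷ ys
⊆-insert xs y = Sublistₚ.++⁺ ⊆-refl (y ∷ʳ ⊆-refl)

Above : List ℕ → List ℕ → Set
Above xs ys = ∀ {x y} → x ∈ xs → y ∈ ys → y < x

↭oneTo-blocks : ∀ N α β → α ++ β ↭ oneTo N → Above α β →
  β ↭ oneTo (length β) × α ↭ map (length β +_) (oneTo (length α))
↭oneTo-blocks zero [] [] _ _ = ↭-refl , ↭-refl
↭oneTo-blocks zero [] (_ ∷ _) p _ with Permₚ.↭-empty-inv p
... | ()
↭oneTo-blocks zero (_ ∷ _) _ p _ with Permₚ.↭-empty-inv p
... | ()
↭oneTo-blocks (suc N) α β p α>β with ∈-++⁻ α (↭oneTo⇒max∈ p)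
↭oneTo-blocks (suc N) [] β p α>β | inj₂ _ =
  subst (λ n → β ↭ oneTo n) (sym (↭oneTo⇒length p)) p , ↭-refl
↭oneTo-blocks (suc N) (a ∷ α) β p α>β | inj₂ N∈β =
  ⊥-elim (ℕₚ.<-irrefl refl (ℕₚ.<-≤-trans (α>β (here refl) N∈β) (proj₂ (All.lookup (↭oneTo⇒bounded p) (here refl)))))
↭oneTo-blocks (suc N) α β p α>β | inj₁ N∈α with ∈-∃++ N∈α
... | α₁ , α₂ , refl = proj₁ IH , α↭
  where
  open ≡-Reasoning
  IH = ↭oneTo-blocks N (α₁ ++ α₂) β
         (subst (_↭ oneTo N) (sym (Listₚ.++-assoc α₁ α₂ β))
           (↭oneTo-remove-max α₁ (α₂ ++ β) (subst (_↭ oneTo (suc N)) (Listₚ.++-assoc α₁ (suc N ∷ α₂) β) p)))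
         (λ a∈ b∈ → α>β (Sublistₚ.Any-resp-⊆ (⊆-insert α₁ (suc N)) a∈) b∈)
  L = length (α₁ ++ α₂)
  B = length β
  N≡B+L : suc N ≡ B + suc L
  N≡B+L = begin
    suc N                                 ≡⟨ ↭oneTo⇒length p ⟨
    length ((α₁ ++ suc N ∷ α₂) ++ β)       ≡⟨ Listₚ.length-++ (α₁ ++ suc N ∷ α₂) ⟩
    length (α₁ ++ suc N ∷ α₂) + B          ≡⟨ cong (_+ B) (Listₚ.length-++-sucʳ α₁ (suc N) α₂) ⟩
    suc L + B                             ≡⟨ ℕₚ.+-comm (suc L) B ⟩
    B + suc L                             ∎
  α↭ : α₁ ++ suc N ∷ α₂ ↭ map (B +_) (oneTo (length (α₁ ++ suc N ∷ α₂)))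
  α↭ = ↭-trans (Permₚ.shift (suc N) α₁ α₂) (↭-trans (Permₚ.++-comm [ suc N ] (α₁ ++ α₂))
       (↭-trans (Permₚ.++⁺ʳ [ suc N ] (proj₂ IH)) (↭-reflexive (begin
         map (B +_) (oneTo L) ++ [ suc N ]          ≡⟨ cong (λ x → map (B +_) (oneTo L) ++ [ x ]) N≡B+L ⟩
         map (B +_) (oneTo L) ++ map (B +_) [ suc L ] ≡⟨ Listₚ.map-++ (B +_) (oneTo L) [ suc L ] ⟨
         map (B +_) (oneTo L ++ [ suc L ])            ≡⟨ cong (map (B +_)) (oneTo-snoc L) ⟨
         map (B +_) (oneTo (suc L))                   ≡⟨ cong (map (B +_) ∘ oneTo) (Listₚ.length-++-sucʳ α₁ (suc N) α₂) ⟨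
         map (B +_) (oneTo (length (α₁ ++ suc N ∷ α₂))) ∎))))

unshift-↭oneTo : ∀ j m xs → xs ↭ map (j +_) (oneTo m) →
  xs ≡ map (j +_) (map (_∸ j) xs) × map (_∸ j) xs ↭ oneTo m
unshift-↭oneTo j m xs p = sym shift∘unshift , ↭-trans (Permₚ.map⁺ (_∸ j) p)
  (↭-reflexive (trans (sym (Listₚ.map-∘ (oneTo m))) (Listₚ.map-id-local (All.tabulate (λ {x} _ → ℕₚ.m+n∸m≡n j x)))))
  where
  j≤ : ∀ {x} → x ∈ xs → j ≤ x
  j≤ x∈ with ∈-map⁻ (j +_) (Permₚ.∈-resp-↭ p x∈)
  ... | y , _ , refl = ℕₚ.m≤m+n j y
  shift∘unshift : map (j +_) (map (_∸ j) xs) ≡ xs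
  shift∘unshift = trans (sym (Listₚ.map-∘ xs))
    (Listₚ.map-id-local (All.tabulate (λ x∈ → trans (ℕₚ.+-comm j _) (ℕₚ.m∸n+n≡m (j≤ x∈)))))

-- Dumont permutations

DumontStep : ℕ → ℕ → Set
DumontStep a b = (Even a × b < a) ⊎ (Odd a × a < b)

step-<⇒Odd : ∀ {a b} → DumontStep a b → a < b → Odd a
step-<⇒Odd (inj₁ (_ , b<a)) a<b = ⊥-elim (ℕₚ.<-asym b<a a<b)
step-<⇒Odd (inj₂ (o , _)) _ = o

step-Odd⇒< : ∀ {a b} → DumontStep a b → Odd a → a < b
step-Odd⇒< (inj₁ (e , _)) o = ⊥-elim (o e)
step-Odd⇒< (inj₂ (_ , a<b)) _ = a<b

step-Even⇒> : ∀ {a b} → DumontStep a b → Even a → b < a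
step-Even⇒> (inj₁ (_ , b<a)) _ = b<a
step-Even⇒> (inj₂ (o , _)) e = ⊥-elim (o e)

Odd-+ : ∀ {j a} → Even j → Odd a → Odd (j + a)
Odd-+ ej oa e = oa (Even-+⁻ ej e)

Odd-+⁻ : ∀ {j a} → Even j → Odd (j + a) → Odd a
Odd-+⁻ ej o e = o (Even-+ ej e)

DumontStep-shift⁺ : ∀ {j a b} → Even j → DumontStep a b → DumontStep (j + a) (j + b)
DumontStep-shift⁺ {j} ej (inj₁ (e , b<a)) = inj₁ (Even-+ ej e , ℕₚ.+-monoʳ-< j b<a)
DumontStep-shift⁺ {j} ej (inj₂ (o , a<b)) = inj₂ (Odd-+ ej o , ℕₚ.+-monoʳ-< j a<b)

DumontStep-shift⁻ : ∀ {j a b} → Even j → DumontStep (j + a) (j + b) → DumontStep a b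
DumontStep-shift⁻ {j} ej (inj₁ (e , b<a)) = inj₁ (Even-+⁻ ej e , ℕₚ.+-cancelˡ-< j _ _ b<a)
DumontStep-shift⁻ {j} ej (inj₂ (o , a<b)) = inj₂ (Odd-+⁻ ej o , ℕₚ.+-cancelˡ-< j _ _ a<b)

Dumont-shift⁺ : ∀ {j} → Even j → ∀ xs → Dumont xs → Dumont (map (j +_) xs)
Dumont-shift⁺ ej [] _ = tt
Dumont-shift⁺ ej (a ∷ []) o = Odd-+ ej o
Dumont-shift⁺ ej (a ∷ b ∷ xs) (st , d) = DumontStep-shift⁺ ej st , Dumont-shift⁺ ej (b ∷ xs) d

Dumont-shift⁻ : ∀ {j} → Even j → ∀ xs → Dumont (map (j +_) xs) → Dumont xs
Dumont-shift⁻ ej [] _ = tt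
Dumont-shift⁻ ej (a ∷ []) o = Odd-+⁻ ej o
Dumont-shift⁻ ej (a ∷ b ∷ xs) (st , d) = DumontStep-shift⁻ ej st , Dumont-shift⁻ ej (b ∷ xs) d

Dumont-tail : ∀ x ys → Dumont (x ∷ ys) → Dumont ys
Dumont-tail x [] _ = tt
Dumont-tail x (y ∷ ys) (_ , d) = d

Dumont-++⁻ʳ : ∀ xs {ys} → Dumont (xs ++ ys) → Dumont ys
Dumont-++⁻ʳ [] d = d
Dumont-++⁻ʳ (x ∷ xs) d = Dumont-++⁻ʳ xs (Dumont-tail x (xs ++ _) d)

Dumont-last : ∀ xs x → Dumont (xs ++ [ x ]) → Odd x
Dumont-last xs x = Dumont-++⁻ʳ xs

Dumont-step : ∀ xs x y ys → Dumont (xs ++ x ∷ y ∷ ys) → DumontStep x y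
Dumont-step xs x y ys = proj₁ ∘ Dumont-++⁻ʳ xs

-- The prefix ends with an ascent, so its last entry is odd.
Dumont-++⁻ˡ : ∀ xs x ys → Dumont (xs ++ x ∷ ys) → All (_< x) xs → Dumont xs
Dumont-++⁻ˡ [] x ys _ _ = tt
Dumont-++⁻ˡ (a ∷ []) x ys (st , _) (a<x ∷ []) = step-<⇒Odd st a<x
Dumont-++⁻ˡ (a ∷ b ∷ xs) x ys (st , d) (_ ∷ xs<x) = st , Dumont-++⁻ˡ (b ∷ xs) x ys d xs<x

Dumont-++⁺ : ∀ xs y ys → Dumont xs → All (_< y) xs → Dumont (y ∷ ys) → Dumont (xs ++ y ∷ ys)
Dumont-++⁺ [] y ys _ _ d = d
Dumont-++⁺ (a ∷ []) y ys oa (a<y ∷ []) d = inj₂ (oa , a<y) , d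
Dumont-++⁺ (a ∷ b ∷ xs) y ys (st , d′) (_ ∷ xs<y) d = st , Dumont-++⁺ (b ∷ xs) y ys d′ xs<y d


-- Pattern containment

⊆-++⁻ : ∀ (xs : List ℕ) {ys s} → s ⊆ xs ++ ys → ∃₂ λ s₁ s₂ → s ≡ s₁ ++ s₂ × s₁ ⊆ xs × s₂ ⊆ ys
⊆-++⁻ [] p = [] , _ , refl , [] , p
⊆-++⁻ (x ∷ xs) (.x ∷ʳ p) with ⊆-++⁻ xs p
... | s₁ , s₂ , refl , p₁ , p₂ = s₁ , s₂ , refl , x ∷ʳ p₁ , p₂
⊆-++⁻ (x ∷ xs) (refl ∷ p) with ⊆-++⁻ xs p
... | s₁ , s₂ , refl , p₁ , p₂ = x ∷ s₁ , s₂ , refl , refl ∷ p₁ , p₂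

⊆-map⁻ : ∀ (f : ℕ → ℕ) xs {s} → s ⊆ map f xs → ∃ λ s′ → s ≡ map f s′ × s′ ⊆ xs
⊆-map⁻ f [] [] = [] , refl , []
⊆-map⁻ f (x ∷ xs) (._ ∷ʳ p) with ⊆-map⁻ f xs p
... | s′ , refl , q = s′ , refl , x ∷ʳ q
⊆-map⁻ f (x ∷ xs) (refl ∷ p) with ⊆-map⁻ f xs p
... | s′ , refl , q = x ∷ s′ , refl , refl ∷ q

∈-resp-⊆ : ∀ {x} {s xs : List ℕ} → x ∈ s → s ⊆ xs → x ∈ xs
∈-resp-⊆ x∈ s⊆ = Sublistₚ.Any-resp-⊆ s⊆ x∈

⊆-++ʳ : ∀ (xs : List ℕ) {ys} → xs ⊆ xs ++ ys
⊆-++ʳ xs {ys} = Sublistₚ.++⁺ʳ ys ⊆-refl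

Increasing-⊆ : ∀ {s xs} → Increasing xs → s ⊆ xs → Increasing s
Increasing-⊆ [] [] = []
Increasing-⊆ (_ ∷ xs↑) (y ∷ʳ p) = Increasing-⊆ xs↑ p
Increasing-⊆ (x< ∷ xs↑) (refl ∷ p) = Sublistₚ.All-resp-⊆ p x< ∷ Increasing-⊆ xs↑ p

Increasing-snoc : ∀ {s m} → Increasing s → All (_< m) s → Increasing (s ++ [ m ])
Increasing-snoc s↑ s<m = AllPairsₚ.++⁺ s↑ ([] ∷ []) (All.map (_∷ []) s<m)

Increasing-++⁻ˡ : ∀ s₁ {s₂} → Increasing (s₁ ++ s₂) → Increasing s₁
Increasing-++⁻ˡ s₁ s↑ = Increasing-⊆ s↑ (⊆-++ʳ s₁)

Increasing-blocks : ∀ s₁ s₂ xs ys → Increasing (s₁ ++ s₂) → s₁ ⊆ xs → s₂ ⊆ ys → Above xs ys →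
  s₁ ≡ [] ⊎ s₂ ≡ []
Increasing-blocks [] s₂ xs ys _ _ _ _ = inj₁ refl
Increasing-blocks (a ∷ s₁) [] xs ys _ _ _ _ = inj₂ refl
Increasing-blocks (a ∷ s₁) (b ∷ s₂) xs ys (a< ∷ _) p₁ p₂ xs>ys =
  ⊥-elim (ℕₚ.<-asym (xs>ys (∈-resp-⊆ (here refl) p₁) (∈-resp-⊆ (here refl) p₂))
                    (All.lookup a< (∈-++⁺ʳ s₁ (here refl))))

Alike : ℕ → ℕ → ℕ → ℕ → Set
Alike a b x y = (a < x ⇔ b < y) × (x < a ⇔ y < b)

Alike-above : ∀ {a b x y} → a < x → b < y → Alike a b x y
Alike-above a<x b<y = mk⇔ (λ _ → b<y) (λ _ → a<x) , mk⇔ (⊥-elim ∘ ℕₚ.<-asym a<x) (⊥-elim ∘ ℕₚ.<-asym b<y)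

Alike-below : ∀ {a b x y} → x < a → y < b → Alike a b x y
Alike-below x<a y<b = mk⇔ (⊥-elim ∘ ℕₚ.<-asym x<a) (⊥-elim ∘ ℕₚ.<-asym y<b) , mk⇔ (λ _ → y<b) (λ _ → x<a)

Alike-shift⁺ : ∀ j {a b x y} → Alike a b x y → Alike (j + a) b (j + x) y
Alike-shift⁺ j (above , below) =
  mk⇔ (Equivalence.to above ∘ ℕₚ.+-cancelˡ-< j _ _) (ℕₚ.+-monoʳ-< j ∘ Equivalence.from above) ,
  mk⇔ (Equivalence.to below ∘ ℕₚ.+-cancelˡ-< j _ _) (ℕₚ.+-monoʳ-< j ∘ Equivalence.from below)

Alike-shift⁻ : ∀ j {a b x y} → Alike (j + a) b (j + x) y → Alike a b x y
Alike-shift⁻ j (above , below) =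
  mk⇔ (Equivalence.to above ∘ ℕₚ.+-monoʳ-< j) (ℕₚ.+-cancelˡ-< j _ _ ∘ Equivalence.from above) ,
  mk⇔ (Equivalence.to below ∘ ℕₚ.+-monoʳ-< j) (ℕₚ.+-cancelˡ-< j _ _ ∘ Equivalence.from below)

Pointwise-Alike-above⁻ : ∀ {a b u v} → Pointwise (Alike a b) u v → All (b <_) v → All (a <_) u
Pointwise-Alike-above⁻ [] [] = []
Pointwise-Alike-above⁻ (x∼y ∷ u∼v) (b<y ∷ b<v) = Equivalence.from (proj₁ x∼y) b<y ∷ Pointwise-Alike-above⁻ u∼v b<v

Pointwise-Alike-above⁺ : ∀ {a b} u v → All (a <_) u → All (b <_) v → length u ≡ length v → Pointwise (Alike a b) u v
Pointwise-Alike-above⁺ [] [] _ _ _ = []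
Pointwise-Alike-above⁺ (x ∷ u) (y ∷ v) (a<x ∷ a<u) (b<y ∷ b<v) eq =
  Alike-above a<x b<y ∷ Pointwise-Alike-above⁺ u v a<u b<v (ℕₚ.suc-injective eq)

Pointwise-snoc⁻ : ∀ {R : ℕ → ℕ → Set} s t {c d} → Pointwise R (s ++ [ c ]) (t ++ [ d ]) → length s ≡ length t →
  Pointwise R s t × R c d
Pointwise-snoc⁻ [] [] (r ∷ []) _ = [] , r
Pointwise-snoc⁻ (x ∷ s) (y ∷ t) (r ∷ rs) eq with Pointwise-snoc⁻ s t rs (ℕₚ.suc-injective eq)
... | s∼t , c∼d = r ∷ s∼t , c∼d

OrderIso-increasing⁻ : ∀ u v → Increasing v → OrderIso u v → Increasing u × length u ≡ length v
OrderIso-increasing⁻ [] [] _ _ = [] , refl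
OrderIso-increasing⁻ (a ∷ u) (b ∷ v) (b< ∷ v↑) (u∼v , u≅v) with OrderIso-increasing⁻ u v v↑ u≅v
... | u↑ , eq = Pointwise-Alike-above⁻ u∼v b< ∷ u↑ , cong suc eq

OrderIso-increasing⁺ : ∀ u v → Increasing u → Increasing v → length u ≡ length v → OrderIso u v
OrderIso-increasing⁺ [] [] _ _ _ = tt
OrderIso-increasing⁺ (a ∷ u) (b ∷ v) (a< ∷ u↑) (b< ∷ v↑) eq =
  Pointwise-Alike-above⁺ u v a< b< (ℕₚ.suc-injective eq) , OrderIso-increasing⁺ u v u↑ v↑ (ℕₚ.suc-injective eq)

OrderIso-dip⁻ : ∀ u v d → Increasing v → All (d <_) v → OrderIso u (v ++ [ d ]) →
  ∃₂ λ s c → u ≡ s ++ [ c ] × Increasing s × All (c <_) s × length s ≡ length v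
OrderIso-dip⁻ (c ∷ []) [] d _ _ ([] , _) = [] , c , refl , [] , [] , refl
OrderIso-dip⁻ (a ∷ u) (b ∷ v) d (b< ∷ v↑) (d<b ∷ d<v) (u∼v , u≅v) with OrderIso-dip⁻ u v d v↑ d<v u≅v
... | s , c , refl , s↑ , c<s , eq with Pointwise-snoc⁻ s v u∼v eq
... | s∼v , c∼d = a ∷ s , c , refl , Pointwise-Alike-above⁻ s∼v b< ∷ s↑ ,
                  Equivalence.from (proj₂ c∼d) d<b ∷ c<s , cong suc eq

OrderIso-dip⁺ : ∀ s v c d → Increasing s → All (c <_) s → Increasing v → All (d <_) v → length s ≡ length v →
  OrderIso (s ++ [ c ]) (v ++ [ d ])
OrderIso-dip⁺ [] [] c d _ _ _ _ _ = [] , tt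
OrderIso-dip⁺ (a ∷ s) (b ∷ v) c d (a< ∷ s↑) (c<a ∷ c<s) (b< ∷ v↑) (d<b ∷ d<v) eq =
  Pointwise.++⁺ (Pointwise-Alike-above⁺ s v a< b< (ℕₚ.suc-injective eq)) (Alike-below c<a d<b ∷ []) ,
  OrderIso-dip⁺ s v c d s↑ c<s v↑ d<v (ℕₚ.suc-injective eq)

OrderIso-shift⁺ : ∀ j s σ → OrderIso s σ → OrderIso (map (j +_) s) σ
OrderIso-shift⁺ j [] [] _ = tt
OrderIso-shift⁺ j (a ∷ s) (b ∷ σ) (s∼σ , s≅σ) = shift-Pointwise s∼σ , OrderIso-shift⁺ j s σ s≅σ
  where
  shift-Pointwise : ∀ {s σ} → Pointwise (Alike a b) s σ → Pointwise (Alike (j + a) b) (map (j +_) s) σ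
  shift-Pointwise [] = []
  shift-Pointwise (x∼y ∷ s∼σ) = Alike-shift⁺ j x∼y ∷ shift-Pointwise s∼σ

OrderIso-shift⁻ : ∀ j s σ → OrderIso (map (j +_) s) σ → OrderIso s σ
OrderIso-shift⁻ j [] [] _ = tt
OrderIso-shift⁻ j (a ∷ s) (b ∷ σ) (s∼σ , s≅σ) = unshift-Pointwise s∼σ , OrderIso-shift⁻ j s σ s≅σ
  where
  unshift-Pointwise : ∀ {s σ} → Pointwise (Alike (j + a) b) (map (j +_) s) σ → Pointwise (Alike a b) s σ
  unshift-Pointwise {[]} {[]} [] = []
  unshift-Pointwise {x ∷ s} {y ∷ σ} (x∼y ∷ s∼σ) = Alike-shift⁻ j x∼y ∷ unshift-Pointwise s∼σ

Avoids-⊆ : ∀ {σ π π′} → Avoids σ π → π′ ⊆ π → Avoids σ π′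
Avoids-⊆ av π′⊆π (s , s⊆ , s≅σ) = av (s , ⊆-trans s⊆ π′⊆π , s≅σ)

Contains-shift⁺ : ∀ j {σ π} → Contains σ π → Contains σ (map (j +_) π)
Contains-shift⁺ j {σ} (s , s⊆ , s≅σ) = map (j +_) s , Sublistₚ.map⁺ (j +_) s⊆ , OrderIso-shift⁺ j s σ s≅σ

Contains-shift⁻ : ∀ j {σ π} → Contains σ (map (j +_) π) → Contains σ π
Contains-shift⁻ j {σ} {π} (s , s⊆ , s≅σ) with ⊆-map⁻ (j +_) π s⊆
... | s′ , refl , s′⊆ = s′ , s′⊆ , OrderIso-shift⁻ j s′ σ s≅σ

Avoids-shift⁺ : ∀ j {σ π} → Avoids σ π → Avoids σ (map (j +_) π)
Avoids-shift⁺ j av = av ∘ Contains-shift⁻ j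

Avoids-shift⁻ : ∀ j {σ π} → Avoids σ (map (j +_) π) → Avoids σ π
Avoids-shift⁻ j av = av ∘ Contains-shift⁺ j

HasIncreasing : ℕ → List ℕ → Set
HasIncreasing r π = ∃ λ s → s ⊆ π × Increasing s × r ≤ length s

length-take-≤ : ∀ r (s : List ℕ) → r ≤ length s → length (take r s) ≡ r
length-take-≤ r s r≤ = trans (Listₚ.length-take r s) (ℕₚ.m≤n⇒m⊓n≡m r≤)

HasIncreasing-exact : ∀ {r π} → HasIncreasing r π → ∃ λ s → s ⊆ π × Increasing s × length s ≡ r
HasIncreasing-exact {r} (s , s⊆ , s↑ , r≤) =
  take r s , ⊆-trans (Sublistₚ.take-⊆ r s) s⊆ , Increasing-⊆ s↑ (Sublistₚ.take-⊆ r s) , length-take-≤ r s r≤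

Contains-oneTo⇒HasIncreasing : ∀ r π → Contains (oneTo r) π → HasIncreasing r π
Contains-oneTo⇒HasIncreasing r π (u , u⊆ , u≅) with OrderIso-increasing⁻ u (oneTo r) (oneTo-increasing r) u≅
... | u↑ , eq = u , u⊆ , u↑ , ℕₚ.≤-reflexive (sym (trans eq (length-oneTo r)))

HasIncreasing⇒Contains-oneTo : ∀ r π → HasIncreasing r π → Contains (oneTo r) π
HasIncreasing⇒Contains-oneTo r π h with HasIncreasing-exact h
... | s , s⊆ , s↑ , refl =
  s , s⊆ , OrderIso-increasing⁺ s (oneTo (length s)) s↑ (oneTo-increasing (length s)) (sym (length-oneTo (length s)))

HasIncreasing-⊆ : ∀ {r π π′} → HasIncreasing r π → π ⊆ π′ → HasIncreasing r π′
HasIncreasing-⊆ (s , s⊆ , s↑ , r≤) π⊆ = s , ⊆-trans s⊆ π⊆ , s↑ , r≤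

HasIncreasing-shift⁺ : ∀ j {r π} → HasIncreasing r π → HasIncreasing r (map (j +_) π)
HasIncreasing-shift⁺ j {r} {π} = Contains-oneTo⇒HasIncreasing r _ ∘ Contains-shift⁺ j ∘ HasIncreasing⇒Contains-oneTo r π

HasIncreasing-shift⁻ : ∀ j {r π} → HasIncreasing r (map (j +_) π) → HasIncreasing r π
HasIncreasing-shift⁻ j {r} {π} = Contains-oneTo⇒HasIncreasing r π ∘ Contains-shift⁻ j ∘ HasIncreasing⇒Contains-oneTo r _

HasIncreasing-blocks : ∀ {r} xs ys → HasIncreasing r (xs ++ ys) → Above xs ys → HasIncreasing r xs ⊎ HasIncreasing r ys
HasIncreasing-blocks xs ys (s , s⊆ , s↑ , r≤) xs>ys with ⊆-++⁻ xs s⊆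
... | s₁ , s₂ , refl , p₁ , p₂ with Increasing-blocks s₁ s₂ xs ys s↑ p₁ p₂ xs>ys
... | inj₁ refl = inj₂ (s₂ , p₂ , s↑ , r≤)
... | inj₂ refl = inj₁ (s₁ , p₁ , Increasing-++⁻ˡ s₁ s↑ , subst (_ ≤_) (cong length (Listₚ.++-identityʳ s₁)) r≤)

HasIncreasing-dropʳ : ∀ r k xs ys → HasIncreasing (k + r) (xs ++ ys) → length ys ≤ k → HasIncreasing r xs
HasIncreasing-dropʳ r k xs ys (s , s⊆ , s↑ , k+r≤) ys≤k with ⊆-++⁻ xs s⊆
... | s₁ , s₂ , refl , p₁ , p₂ = s₁ , p₁ , Increasing-++⁻ˡ s₁ s↑ , ℕₚ.+-cancelˡ-≤ k r (length s₁) (begin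
  k + r                    ≤⟨ k+r≤ ⟩
  length (s₁ ++ s₂)        ≡⟨ Listₚ.length-++ s₁ ⟩
  length s₁ + length s₂    ≤⟨ ℕₚ.+-monoʳ-≤ (length s₁) (ℕₚ.≤-trans (Sublistₚ.length-mono-≤ p₂) ys≤k) ⟩
  length s₁ + k            ≡⟨ ℕₚ.+-comm (length s₁) k ⟩
  k + length s₁            ∎)
  where open ℕₚ.≤-Reasoning

HasIncreasing-snoc : ∀ {r xs m} → HasIncreasing r xs → All (_< m) xs → HasIncreasing (suc r) (xs ++ [ m ])
HasIncreasing-snoc {r} {xs} {m} (s , s⊆ , s↑ , r≤) xs<m =
  s ++ [ m ] , Sublistₚ.++⁺ s⊆ ⊆-refl , Increasing-snoc s↑ (Sublistₚ.All-resp-⊆ s⊆ xs<m) ,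
  ℕₚ.≤-trans (s≤s r≤) (ℕₚ.≤-reflexive (trans (ℕₚ.+-comm 1 (length s)) (sym (Listₚ.length-++ s))))

¬HasIncreasing-[x] : ∀ {r x} → ¬ HasIncreasing (2 + r) [ x ]
¬HasIncreasing-[x] (s , s⊆ , _ , 2+r≤) with ℕₚ.≤-trans 2+r≤ (Sublistₚ.length-mono-≤ s⊆)
... | s≤s ()

-- Containment of 23…(q+3)1: an increasing run of length q + 2 followed by an entry below all of it.
HasDip : ℕ → List ℕ → Set
HasDip q π = ∃₂ λ s c → s ++ [ c ] ⊆ π × Increasing s × All (c <_) s × length s ≡ 2 + q

p23k1-increasing : ∀ q → Increasing (map (2 +_) (upTo (2 + q)))
p23k1-increasing q = AllPairsₚ.map⁺ (AllPairs.map (ℕₚ.+-monoʳ-< 2) (upTo-increasing (2 + q)))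

p23k1-above-1 : ∀ q → All (1 <_) (map (2 +_) (upTo (2 + q)))
p23k1-above-1 q = Allₚ.map⁺ (All.universal (λ _ → s≤s (s≤s z≤n)) (upTo (2 + q)))

length-p23k1-run : ∀ q → length (map (2 +_) (upTo (2 + q))) ≡ 2 + q
length-p23k1-run q = trans (Listₚ.length-map (2 +_) (upTo (2 + q))) (Listₚ.length-applyUpTo (λ i → i) (2 + q))

Contains-p23k1⇒HasDip : ∀ q π → Contains (p23k1 (3 + q)) π → HasDip q π
Contains-p23k1⇒HasDip q π (u , u⊆ , u≅) with OrderIso-dip⁻ u _ 1 (p23k1-increasing q) (p23k1-above-1 q) u≅
... | s , c , refl , s↑ , c<s , eq = s , c , u⊆ , s↑ , c<s , trans eq (length-p23k1-run q)

HasDip⇒Contains-p23k1 : ∀ q π → HasDip q π → Contains (p23k1 (3 + q)) π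
HasDip⇒Contains-p23k1 q π (s , c , s⊆ , s↑ , c<s , eq) =
  s ++ [ c ] , s⊆ , OrderIso-dip⁺ s _ c 1 s↑ c<s (p23k1-increasing q) (p23k1-above-1 q) (trans eq (sym (length-p23k1-run q)))

HasDip-drop-max-head : ∀ {q} x ys → HasDip q (x ∷ ys) → All (_< x) ys → HasDip q ys
HasDip-drop-max-head x ys ([] , c , _ , _ , _ , ())
HasDip-drop-max-head x ys (a ∷ [] , c , _ , _ , _ , ())
HasDip-drop-max-head x ys (a ∷ b ∷ s , c , .x ∷ʳ s⊆ , rest) _ = a ∷ b ∷ s , c , s⊆ , rest
HasDip-drop-max-head x ys (a ∷ b ∷ s , c , refl ∷ s⊆ , (a< ∷ _) , _) ys<x =
  ⊥-elim (ℕₚ.<-asym (All.lookup a< (here refl)) (All.lookup ys<x (∈-resp-⊆ (here refl) s⊆)))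

HasDip-drop-max-last : ∀ {q} ys x → HasDip q (ys ++ [ x ]) → All (_< x) ys → HasDip q ys
HasDip-drop-max-last ys x (s , c , s⊆ , s↑ , c<s , eq) ys<x with ⊆-++⁻ ys s⊆
... | u₁ , [] , e , p₁ , p₂ = s , c , subst (_⊆ ys) (sym (trans e (Listₚ.++-identityʳ u₁))) p₁ , s↑ , c<s , eq
... | u₁ , (y ∷ []) , e , p₁ , (refl ∷ []) with Listₚ.∷ʳ-injective s u₁ e
...   | refl , refl with s | c<s | eq
...     | a ∷ s′ | c<a ∷ _ | _ = ⊥-elim (ℕₚ.<-asym c<a (All.lookup ys<x (∈-resp-⊆ (here refl) p₁)))
HasDip-drop-max-last ys x _ _ | u₁ , (y ∷ []) , e , p₁ , (.x ∷ʳ ())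
HasDip-drop-max-last ys x _ _ | u₁ , (y ∷ z ∷ u₂) , e , p₁ , (.x ∷ʳ ())
HasDip-drop-max-last ys x _ _ | u₁ , (y ∷ z ∷ u₂) , e , p₁ , (refl ∷ ())

snoc-≡-++ : ∀ (s : List ℕ) c u₁ u₂ → s ++ [ c ] ≡ u₁ ++ u₂ →
  (u₂ ≡ [] × u₁ ≡ s ++ [ c ]) ⊎ ∃ λ u₂′ → u₂ ≡ u₂′ ++ [ c ] × s ≡ u₁ ++ u₂′
snoc-≡-++ s c [] u₂ e = inj₂ (s , sym e , refl)
snoc-≡-++ [] c (a ∷ []) [] refl = inj₁ (refl , refl)
snoc-≡-++ [] c (a ∷ []) (_ ∷ _) ()
snoc-≡-++ [] c (a ∷ _ ∷ _) u₂ ()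
snoc-≡-++ (b ∷ s) c (a ∷ u₁) u₂ e with Listₚ.∷-injective e
... | refl , e′ with snoc-≡-++ s c u₁ u₂ e′
...   | inj₁ (p , q) = inj₁ (p , cong (b ∷_) q)
...   | inj₂ (u₂′ , p , q) = inj₂ (u₂′ , p , cong (b ∷_) q)

HasDip-blocks : ∀ {q} xs ys → HasDip q (xs ++ ys) → Above xs ys → HasDip q ys ⊎ HasIncreasing (2 + q) xs
HasDip-blocks xs ys (s , c , s⊆ , s↑ , c<s , eq) xs>ys with ⊆-++⁻ xs s⊆
... | u₁ , u₂ , e , p₁ , p₂ with snoc-≡-++ s c u₁ u₂ e
...   | inj₁ (refl , refl) = inj₂ (s , ⊆-trans (⊆-++ʳ s) p₁ , s↑ , ℕₚ.≤-reflexive (sym eq))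
...   | inj₂ (u₂′ , refl , refl) with Increasing-blocks u₁ u₂′ xs ys s↑ p₁ (⊆-trans (⊆-++ʳ u₂′) p₂) xs>ys
...     | inj₁ refl = inj₁ (u₂′ , c , p₂ , s↑ , c<s , eq)
...     | inj₂ refl = inj₂ (u₁ , p₁ , Increasing-++⁻ˡ u₁ s↑ ,
                            ℕₚ.≤-reflexive (sym (trans (sym (cong length (Listₚ.++-identityʳ u₁))) eq)))

Has132 : List ℕ → Set
Has132 π = ∃₂ λ a b → ∃ λ c → a ∷ b ∷ c ∷ [] ⊆ π × a < c × c < b

Contains-132⇒Has132 : ∀ π → Contains p132 π → Has132 π
Contains-132⇒Has132 π ([] , _ , ())
Contains-132⇒Has132 π (a ∷ [] , _ , (() , _))
Contains-132⇒Has132 π (a ∷ b ∷ [] , _ , ((_ ∷ ()) , _))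
Contains-132⇒Has132 π (a ∷ b ∷ c ∷ _ ∷ _ , _ , ((_ ∷ _ ∷ ()) , _))
Contains-132⇒Has132 π (a ∷ b ∷ c ∷ [] , s⊆ , ((_ ∷ a∼c ∷ []) , (b∼c ∷ []) , _)) =
  a , b , c , s⊆ , Equivalence.from (proj₁ a∼c) (s≤s (s≤s z≤n)) , Equivalence.from (proj₂ b∼c) (s≤s (s≤s (s≤s z≤n)))

Has132⇒Contains-132 : ∀ π → Has132 π → Contains p132 π
Has132⇒Contains-132 π (a , b , c , s⊆ , a<c , c<b) = a ∷ b ∷ c ∷ [] , s⊆ ,
  ((Alike-above (ℕₚ.<-trans a<c c<b) (s≤s (s≤s z≤n)) ∷ Alike-above a<c (s≤s (s≤s z≤n)) ∷ []) ,
   (Alike-below c<b (s≤s (s≤s (s≤s z≤n))) ∷ []) , ([] , tt))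

Avoids132-blocks : ∀ xs ys → Avoids p132 xs → Avoids p132 ys → Above xs ys → Avoids p132 (xs ++ ys)
Avoids132-blocks xs ys av-xs av-ys xs>ys c with Contains-132⇒Has132 _ c
... | a , b , c′ , s⊆ , a<c , c<b with ⊆-++⁻ xs s⊆
... | [] , _ , refl , _ , p₂ = av-ys (Has132⇒Contains-132 ys (a , b , c′ , p₂ , a<c , c<b))
... | (_ ∷ []) , _ , refl , p₁ , p₂ =
  ℕₚ.<-asym a<c (xs>ys (∈-resp-⊆ (here refl) p₁) (∈-resp-⊆ (there (here refl)) p₂))
... | (_ ∷ _ ∷ []) , _ , refl , p₁ , p₂ = ℕₚ.<-asym a<c (xs>ys (∈-resp-⊆ (here refl) p₁) (∈-resp-⊆ (here refl) p₂))
... | (_ ∷ _ ∷ _ ∷ []) , [] , refl , p₁ , _ = av-xs (Has132⇒Contains-132 xs (a , b , c′ , p₁ , a<c , c<b))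

Avoids132-snoc-max : ∀ xs m → Avoids p132 xs → All (_< m) xs → Avoids p132 (xs ++ [ m ])
Avoids132-snoc-max xs m av xs<m c with Contains-132⇒Has132 _ c
... | a , b , c′ , s⊆ , a<c , c<b with ⊆-++⁻ xs s⊆
... | (_ ∷ _ ∷ _ ∷ []) , [] , refl , p₁ , _ = av (Has132⇒Contains-132 xs (a , b , c′ , p₁ , a<c , c<b))
... | (_ ∷ _ ∷ []) , _ , refl , p₁ , (refl ∷ []) = ℕₚ.<-asym c<b (All.lookup xs<m (∈-resp-⊆ (there (here refl)) p₁))
... | (_ ∷ _ ∷ []) , _ , refl , _ , (_ ∷ʳ ())
... | (_ ∷ []) , _ , refl , _ , (_ ∷ʳ ())
... | (_ ∷ []) , _ , refl , _ , (refl ∷ ())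
... | [] , _ , refl , _ , (_ ∷ʳ ())
... | [] , _ , refl , _ , (refl ∷ ())

Avoids132-cons-max : ∀ m ys → Avoids p132 ys → All (_< m) ys → Avoids p132 (m ∷ ys)
Avoids132-cons-max m ys av ys<m c with Contains-132⇒Has132 _ c
... | a , b , c′ , (_ ∷ʳ s⊆) , a<c , c<b = av (Has132⇒Contains-132 ys (a , b , c′ , s⊆ , a<c , c<b))
... | a , b , c′ , (refl ∷ s⊆) , a<c , c<b = ℕₚ.<-asym a<c (All.lookup ys<m (∈-resp-⊆ (there (here refl)) s⊆))

Avoids132-gap : ∀ α N β {a b} → Avoids p132 (α ++ N ∷ β) → a ∈ α → b ∈ β → b < N → ¬ (a < b)
Avoids132-gap α N β av a∈ b∈ b<N a<b =
  av (Has132⇒Contains-132 _ (_ , N , _ , Sublistₚ.++⁺ (from∈ a∈) (refl ∷ from∈ b∈) , a<b , b<N))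

-- Decomposition at the maximum

-- For N = t + 2, the two shapes N β (N−1) and α↑ (N−1) N β of an even-length Dumont
-- permutation avoiding 132; α↑ is α shifted above β, which has length t − i.
maxFirst : ℕ → List ℕ → List ℕ
maxFirst t β = suc (suc t) ∷ β ++ [ suc t ]

maxInside : ℕ → ℕ → List ℕ → List ℕ → List ℕ
maxInside t i α β = map ((t ∸ i) +_) α ++ suc t ∷ suc (suc t) ∷ β

oneTo-snoc₂ : ∀ m → oneTo (suc (suc m)) ≡ oneTo m ++ suc m ∷ suc (suc m) ∷ []
oneTo-snoc₂ m = trans (oneTo-snoc (suc m))
  (trans (cong (_++ [ suc (suc m) ]) (oneTo-snoc m)) (Listₚ.++-assoc (oneTo m) [ suc m ] [ suc (suc m) ]))

maxFirst-↭ : ∀ {t β} → β ↭ oneTo t → maxFirst t β ↭ oneTo (suc (suc t))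
maxFirst-↭ {t} {β} β↭ = ↭-trans (Permₚ.++-comm [ suc (suc t) ] (β ++ [ suc t ]))
  (↭-trans (Permₚ.++⁺ʳ [ suc (suc t) ] (Permₚ.++⁺ʳ [ suc t ] β↭))
  (↭-reflexive (trans (Listₚ.++-assoc (oneTo t) [ suc t ] [ suc (suc t) ]) (sym (oneTo-snoc₂ t)))))

maxInside-↭ : ∀ {t i α β} → i ≤ t → α ↭ oneTo i → β ↭ oneTo (t ∸ i) → maxInside t i α β ↭ oneTo (suc (suc t))
maxInside-↭ {t} {i} {α} {β} i≤t α↭ β↭ =
  ↭-trans (↭-reflexive (sym (Listₚ.++-assoc α↑ M β)))
  (↭-trans (Permₚ.++-comm (α↑ ++ M) β)
  (↭-trans (Permₚ.++⁺ β↭ (Permₚ.++⁺ʳ M (Permₚ.map⁺ ((t ∸ i) +_) α↭)))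
  (↭-reflexive (begin
    oneTo (t ∸ i) ++ map ((t ∸ i) +_) (oneTo i) ++ M   ≡⟨ Listₚ.++-assoc (oneTo (t ∸ i)) _ M ⟨
    (oneTo (t ∸ i) ++ map ((t ∸ i) +_) (oneTo i)) ++ M ≡⟨ cong (_++ M) (oneTo-+ (t ∸ i) i) ⟨
    oneTo ((t ∸ i) + i) ++ M                           ≡⟨ cong (λ n → oneTo n ++ M) (ℕₚ.m∸n+n≡m i≤t) ⟩
    oneTo t ++ M                                       ≡⟨ oneTo-snoc₂ t ⟨
    oneTo (suc (suc t))                                ∎))))
  where
  open ≡-Reasoning
  α↑ = map ((t ∸ i) +_) α
  M = suc t ∷ suc (suc t) ∷ []

shift-bounds : ∀ j {i α} → α ↭ oneTo i → All (λ x → j < x × x ≤ j + i) (map (j +_) α)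
shift-bounds j α↭ =
  Allₚ.map⁺ (All.map (λ (1≤x , x≤i) → ℕₚ.m<m+n j 1≤x , ℕₚ.+-monoʳ-≤ j x≤i) (↭oneTo⇒bounded α↭))

maxInside-left : ℕ → ℕ → List ℕ → List ℕ
maxInside-left t i α = map ((t ∸ i) +_) α ++ suc t ∷ suc (suc t) ∷ []

maxInside-≡-left++ : ∀ t i α β → maxInside t i α β ≡ maxInside-left t i α ++ β
maxInside-≡-left++ t i α β = sym (Listₚ.++-assoc (map ((t ∸ i) +_) α) (suc t ∷ suc (suc t) ∷ []) β)

maxInside-left-≡ : ∀ t i α → maxInside-left t i α ≡ (map ((t ∸ i) +_) α ++ [ suc t ]) ++ [ suc (suc t) ]
maxInside-left-≡ t i α = sym (Listₚ.++-assoc (map ((t ∸ i) +_) α) [ suc t ] [ suc (suc t) ])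

shifted-below-1+t : ∀ {t i α} → i ≤ t → α ↭ oneTo i → All (_< suc t) (map ((t ∸ i) +_) α)
shifted-below-1+t {t} {i} i≤t α↭ =
  All.map (λ (_ , x≤) → s≤s (subst (_ ≤_) (ℕₚ.m∸n+n≡m i≤t) x≤)) (shift-bounds (t ∸ i) α↭)

shifted++[1+t]-below-2+t : ∀ {t i α} → i ≤ t → α ↭ oneTo i → All (_< suc (suc t)) (map ((t ∸ i) +_) α ++ [ suc t ])
shifted++[1+t]-below-2+t {t} i≤t α↭ =
  Allₚ.++⁺ (All.map ℕₚ.m≤n⇒m≤1+n (shifted-below-1+t i≤t α↭)) (ℕₚ.n<1+n (suc t) ∷ [])

left-above-β : ∀ {t i α β} → i ≤ t → α ↭ oneTo i → β ↭ oneTo (t ∸ i) → Above (maxInside-left t i α) β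
left-above-β {t} {i} {α} i≤t α↭ β↭ {x} {y} x∈ y∈
  with ∈-++⁻ (map ((t ∸ i) +_) α) x∈ | proj₂ (All.lookup (↭oneTo⇒bounded β↭) y∈)
... | inj₁ x∈α↑ | y≤ = ℕₚ.≤-<-trans y≤ (proj₁ (All.lookup (shift-bounds (t ∸ i) α↭) x∈α↑))
... | inj₂ (here refl) | y≤ = s≤s (ℕₚ.≤-trans y≤ (ℕₚ.m∸n≤m t i))
... | inj₂ (there (here refl)) | y≤ = s≤s (ℕₚ.≤-trans y≤ (ℕₚ.≤-trans (ℕₚ.m∸n≤m t i) (ℕₚ.n≤1+n t)))

β⊆maxInside : ∀ t i α β → β ⊆ maxInside t i α β
β⊆maxInside t i α β = Sublistₚ.++⁺ˡ (map ((t ∸ i) +_) α) (suc t ∷ʳ (suc (suc t) ∷ʳ ⊆-refl))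

left⊆maxInside : ∀ t i α β → maxInside-left t i α ⊆ maxInside t i α β
left⊆maxInside t i α β = Sublistₚ.++⁺ ⊆-refl (refl ∷ refl ∷ minimum β)

β⊆maxFirst : ∀ t β → β ⊆ maxFirst t β
β⊆maxFirst t β = suc (suc t) ∷ʳ ⊆-++ʳ β

below-2+t : ∀ {t β} → β ↭ oneTo t → All (_< suc (suc t)) (β ++ [ suc t ])
below-2+t {t} β↭ = Allₚ.++⁺ (All.map ℕₚ.m≤n⇒m≤1+n (↭oneTo⇒All< β↭)) (ℕₚ.n<1+n (suc t) ∷ [])

Dumont-even-max-∷ : ∀ {N y} ys → y ∈ ys → Even N → All (_< N) ys → Dumont ys → Dumont (N ∷ ys)
Dumont-even-max-∷ (y ∷ ys) _ e (y<N ∷ _) d = inj₁ (e , y<N) , d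

maxFirst-Dumont : ∀ {t β} → Even t → β ↭ oneTo t → Dumont β → Dumont (maxFirst t β)
maxFirst-Dumont {t} {β} et β↭ d = Dumont-even-max-∷ (β ++ [ suc t ]) (∈-++⁺ʳ β (here refl)) (Even-2+ et) (below-2+t β↭)
  (Dumont-++⁺ β (suc t) [] d (↭oneTo⇒All< β↭) (Even⇒Odd-suc et))

maxInside-Dumont : ∀ {t i α β} → Even t → Even (t ∸ i) → i ≤ t → α ↭ oneTo i → β ↭ oneTo (t ∸ i) →
  1 ≤ t ∸ i → Dumont α → Dumont β → Dumont (maxInside t i α β)
maxInside-Dumont {t} {i} {α} {β} et ej i≤t α↭ β↭ 1≤ dα dβ =
  Dumont-++⁺ (map ((t ∸ i) +_) α) (suc t) (suc (suc t) ∷ β) (Dumont-shift⁺ ej α dα) (shifted-below-1+t i≤t α↭)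
    (inj₂ (Even⇒Odd-suc et , ℕₚ.n<1+n (suc t)) ,
     Dumont-even-max-∷ β (Permₚ.∈-resp-↭ (↭-sym β↭) (∈-oneTo⁺ ℕₚ.≤-refl 1≤)) (Even-2+ et) β<2+t dβ)
  where
  β<2+t : All (_< suc (suc t)) β
  β<2+t = All.map (λ (_ , y≤) → s≤s (ℕₚ.≤-trans y≤ (ℕₚ.≤-trans (ℕₚ.m∸n≤m t i) (ℕₚ.n≤1+n t))))
                  (↭oneTo⇒bounded β↭)

maxFirst-avoids132 : ∀ {t β} → β ↭ oneTo t → Avoids p132 β → Avoids p132 (maxFirst t β)
maxFirst-avoids132 {t} {β} β↭ av = Avoids132-cons-max (suc (suc t)) (β ++ [ suc t ])
  (Avoids132-snoc-max β (suc t) av (↭oneTo⇒All< β↭)) (below-2+t β↭)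

maxInside-avoids132 : ∀ {t i α β} → i ≤ t → α ↭ oneTo i → β ↭ oneTo (t ∸ i) →
  Avoids p132 α → Avoids p132 β → Avoids p132 (maxInside t i α β)
maxInside-avoids132 {t} {i} {α} {β} i≤t α↭ β↭ av-α av-β =
  subst (Avoids p132) (sym (maxInside-≡-left++ t i α β))
    (Avoids132-blocks (maxInside-left t i α) β av-left av-β (left-above-β i≤t α↭ β↭))
  where
  av-left : Avoids p132 (maxInside-left t i α)
  av-left = subst (Avoids p132) (sym (maxInside-left-≡ t i α))
    (Avoids132-snoc-max _ (suc (suc t))
      (Avoids132-snoc-max _ (suc t) (Avoids-shift⁺ (t ∸ i) av-α) (shifted-below-1+t i≤t α↭))
      (shifted++[1+t]-below-2+t i≤t α↭))

private
  ⇒Contains-oneTo = HasIncreasing⇒Contains-oneTo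
  Contains-oneTo⇒ = Contains-oneTo⇒HasIncreasing

maxFirst-avoids-increasing : ∀ r {t β} → β ↭ oneTo t →
  Avoids (oneTo (2 + r)) (maxFirst t β) ⇔ Avoids (oneTo (1 + r)) β
maxFirst-avoids-increasing r {t} {β} β↭ = mk⇔ to from
  where
  to : Avoids (oneTo (2 + r)) (maxFirst t β) → Avoids (oneTo (1 + r)) β
  to av c = av (⇒Contains-oneTo _ _
    (HasIncreasing-⊆ (HasIncreasing-snoc (Contains-oneTo⇒ _ _ c) (↭oneTo⇒All< β↭)) (suc (suc t) ∷ʳ ⊆-refl)))
  N-above : Above [ suc (suc t) ] (β ++ [ suc t ])
  N-above (here refl) y∈ = All.lookup (below-2+t β↭) y∈
  from : Avoids (oneTo (1 + r)) β → Avoids (oneTo (2 + r)) (maxFirst t β)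
  from av c with HasIncreasing-blocks [ suc (suc t) ] (β ++ [ suc t ]) (Contains-oneTo⇒ _ _ c) N-above
  ... | inj₁ h = ¬HasIncreasing-[x] h
  ... | inj₂ h = av (⇒Contains-oneTo _ _ (HasIncreasing-dropʳ (suc r) 1 β [ suc t ] h ℕₚ.≤-refl))

maxInside-avoids-increasing : ∀ r {t i α β} → i ≤ t → α ↭ oneTo i → β ↭ oneTo (t ∸ i) →
  Avoids (oneTo (2 + r)) (maxInside t i α β) ⇔ (Avoids (oneTo r) α × Avoids (oneTo (2 + r)) β)
maxInside-avoids-increasing r {t} {i} {α} {β} i≤t α↭ β↭ = mk⇔ to from
  where
  to : Avoids (oneTo (2 + r)) (maxInside t i α β) → Avoids (oneTo r) α × Avoids (oneTo (2 + r)) β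
  to av = (λ c → av (⇒Contains-oneTo _ _ (HasIncreasing-⊆
            (subst (HasIncreasing (2 + r)) (sym (maxInside-left-≡ t i α))
              (HasIncreasing-snoc (HasIncreasing-snoc (HasIncreasing-shift⁺ (t ∸ i) (Contains-oneTo⇒ _ _ c))
                (shifted-below-1+t i≤t α↭)) (shifted++[1+t]-below-2+t i≤t α↭)))
            (left⊆maxInside t i α β)))) ,
          Avoids-⊆ av (β⊆maxInside t i α β)
  from : Avoids (oneTo r) α × Avoids (oneTo (2 + r)) β → Avoids (oneTo (2 + r)) (maxInside t i α β)
  from (av-α , av-β) c with HasIncreasing-blocks (maxInside-left t i α) β
    (subst (HasIncreasing (2 + r)) (maxInside-≡-left++ t i α β) (Contains-oneTo⇒ _ _ c)) (left-above-β i≤t α↭ β↭)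
  ... | inj₂ h = av-β (⇒Contains-oneTo _ _ h)
  ... | inj₁ h = av-α (⇒Contains-oneTo _ _ (HasIncreasing-shift⁻ (t ∸ i) (HasIncreasing-dropʳ r 2 _ _ h ℕₚ.≤-refl)))

module _ (q : ℕ) where

  private
    Avoids-dip = Avoids (p23k1 (3 + q))

  snoc-avoids-dip : ∀ {n π} → π ↭ oneTo n → Avoids-dip (π ++ [ suc n ]) ⇔ Avoids-dip π
  snoc-avoids-dip {n} {π} π↭ = mk⇔ (λ av → Avoids-⊆ av (⊆-++ʳ π))
    (λ av c → av (HasDip⇒Contains-p23k1 q π
      (HasDip-drop-max-last π (suc n) (Contains-p23k1⇒HasDip q _ c) (↭oneTo⇒All< π↭))))

  maxFirst-avoids-dip : ∀ {t β} → β ↭ oneTo t → Avoids-dip (maxFirst t β) ⇔ Avoids-dip β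
  maxFirst-avoids-dip {t} {β} β↭ = mk⇔ (λ av → Avoids-⊆ av (β⊆maxFirst t β))
    (λ av c → av (HasDip⇒Contains-p23k1 q β (HasDip-drop-max-last β (suc t)
      (HasDip-drop-max-head (suc (suc t)) (β ++ [ suc t ]) (Contains-p23k1⇒HasDip q _ c) (below-2+t β↭))
      (↭oneTo⇒All< β↭))))

  maxInside-avoids-dip : ∀ {t i α β} → i ≤ t → α ↭ oneTo i → β ↭ oneTo (t ∸ i) → 1 ≤ t ∸ i →
    Avoids-dip (maxInside t i α β) ⇔ (Avoids (oneTo q) α × Avoids-dip β)
  maxInside-avoids-dip {t} {i} {α} {β} i≤t α↭ β↭ 1≤ = mk⇔ to from
    where
    to : Avoids-dip (maxInside t i α β) → Avoids (oneTo q) α × Avoids-dip β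
    to av = α-part , Avoids-⊆ av (β⊆maxInside t i α β)
      where
      1∈β : 1 ∈ β
      1∈β = Permₚ.∈-resp-↭ (↭-sym β↭) (∈-oneTo⁺ ℕₚ.≤-refl 1≤)
      -- an increasing run of length q inside α, extended by N − 1 and N, dips down to 1 in β
      α-part : Avoids (oneTo q) α
      α-part c with HasIncreasing-exact (HasIncreasing-shift⁺ (t ∸ i) (Contains-oneTo⇒ _ _ c))
      ... | s , s⊆ , s↑ , |s|≡q = av (HasDip⇒Contains-p23k1 q _ (run , 1 , run++[1]⊆ , run↑ , 1<run , |run|≡))
        where
        run = (s ++ [ suc t ]) ++ [ suc (suc t) ]
        run↑ : Increasing run
        run↑ = Increasing-snoc (Increasing-snoc s↑ (Sublistₚ.All-resp-⊆ s⊆ (shifted-below-1+t i≤t α↭)))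
          (Sublistₚ.All-resp-⊆ (Sublistₚ.++⁺ s⊆ ⊆-refl) (shifted++[1+t]-below-2+t i≤t α↭))
        run⊆left : run ⊆ maxInside-left t i α
        run⊆left = subst (_⊆ _) (sym (Listₚ.++-assoc s [ suc t ] [ suc (suc t) ])) (Sublistₚ.++⁺ s⊆ ⊆-refl)
        1<run : All (1 <_) run
        1<run = All.tabulate (λ x∈ → left-above-β i≤t α↭ β↭ (∈-resp-⊆ x∈ run⊆left) 1∈β)
        run++[1]⊆ : run ++ [ 1 ] ⊆ maxInside t i α β
        run++[1]⊆ = subst (_⊆ _) (sym (trans (Listₚ.++-assoc (s ++ [ suc t ]) [ suc (suc t) ] [ 1 ])
                                            (Listₚ.++-assoc s [ suc t ] (suc (suc t) ∷ [ 1 ]))))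
                      (Sublistₚ.++⁺ s⊆ (refl ∷ refl ∷ from∈ 1∈β))
        |run|≡ : length run ≡ 2 + q
        |run|≡ = trans (Listₚ.length-++ (s ++ [ suc t ])) (trans (cong (_+ 1) (Listₚ.length-++ s))
                   (trans (ℕₚ.+-comm (length s + 1) 1) (cong suc (trans (ℕₚ.+-comm (length s) 1) (cong suc |s|≡q)))))
    from : Avoids (oneTo q) α × Avoids-dip β → Avoids-dip (maxInside t i α β)
    from (av-α , av-β) c with HasDip-blocks (maxInside-left t i α) β
      (subst (HasDip q) (maxInside-≡-left++ t i α β) (Contains-p23k1⇒HasDip q _ c)) (left-above-β i≤t α↭ β↭)
    ... | inj₁ h = av-β (HasDip⇒Contains-p23k1 q β h)
    ... | inj₂ h = av-α (⇒Contains-oneTo _ _ (HasIncreasing-shift⁻ (t ∸ i) (HasIncreasing-dropʳ q 2 _ _ h ℕₚ.≤-refl)))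

even-min-ascent-impossible : ∀ α y ys {m} → Dumont (α ++ y ∷ ys) → m ∈ α → Even m → All (m ≤_) α → m < y → ⊥
even-min-ascent-impossible α y ys {m} d m∈ em m≤α m<y with ∈-∃++ m∈
... | α₁ , [] , refl =
  ℕₚ.<-asym m<y (step-Even⇒> (Dumont-step α₁ m y ys (subst Dumont (Listₚ.++-assoc α₁ [ m ] (y ∷ ys)) d)) em)
... | α₁ , z ∷ α₂ , refl =
  ℕₚ.<⇒≱ (step-Even⇒> (Dumont-step α₁ m z (α₂ ++ y ∷ ys)
                         (subst Dumont (Listₚ.++-assoc α₁ (m ∷ z ∷ α₂) (y ∷ ys)) d)) em)
         (All.lookup m≤α (∈-++⁺ʳ α₁ (there (here refl))))

odd-max-last : ∀ α rest {M} → Dumont (α ++ rest) → M ∈ α → Odd M → All (_≤ M) α → ∃ λ α₁ → α ≡ α₁ ++ [ M ]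
odd-max-last α rest {M} d M∈ oM α≤M with ∈-∃++ M∈
... | α₁ , [] , refl = α₁ , refl
... | α₁ , z ∷ α₂ , refl =
  ⊥-elim (ℕₚ.<⇒≱ (step-Odd⇒< (Dumont-step α₁ M z (α₂ ++ rest)
                                 (subst Dumont (Listₚ.++-assoc α₁ (M ∷ z ∷ α₂) rest) d)) oM)
                 (All.lookup α≤M (∈-++⁺ʳ α₁ (there (here refl)))))

odd-length-shape : ∀ {n π} → Even n → π ↭ oneTo (suc n) → Dumont π →
  ∃ λ π′ → π ≡ π′ ++ [ suc n ] × π′ ↭ oneTo n × Dumont π′
odd-length-shape {n} {π} en π↭ d with odd-max-last π [] (subst Dumont (sym (Listₚ.++-identityʳ π)) d)
  (↭oneTo⇒max∈ π↭) (Even⇒Odd-suc en) (All.map proj₂ (↭oneTo⇒bounded π↭))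
... | π′ , refl = π′ , refl , π′↭ , Dumont-++⁻ˡ π′ (suc n) [] d (↭oneTo⇒All< π′↭)
  where
  π′↭ = ↭oneTo-snoc⁻ π′ π↭

Unique-++⇒disjoint : ∀ (xs : List ℕ) {ys} → Unique (xs ++ ys) → ∀ {x y} → x ∈ xs → y ∈ ys → x ≢ y
Unique-++⇒disjoint (x ∷ xs) (x∉ ∷ _) (here refl) y∈ = All.lookup x∉ (∈-++⁺ʳ xs y∈)
Unique-++⇒disjoint (x ∷ xs) (_ ∷ xs!) (there x∈) y∈ = Unique-++⇒disjoint xs xs! x∈ y∈

Above-around-max : ∀ α N β → α ++ N ∷ β ↭ oneTo N → Avoids p132 (α ++ N ∷ β) → Above α β
Above-around-max α N β π↭ av {x} {y} x∈ y∈ with ℕₚ.<-cmp x y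
... | tri< x<y _ _ = ⊥-elim (Avoids132-gap α N β av x∈ y∈ y<N x<y)
  where
  y≤N = proj₂ (All.lookup (↭oneTo⇒bounded π↭) (∈-++⁺ʳ α (there y∈)))
  π! = subst Unique (sym (Listₚ.++-assoc α [ N ] β)) (↭oneTo⇒Unique π↭)
  y<N = ℕₚ.≤∧≢⇒< y≤N (λ y≡N → Unique-++⇒disjoint (α ++ [ N ]) π! (∈-++⁺ʳ α (here refl)) y∈ (sym y≡N))
... | tri≈ _ x≡y _ = ⊥-elim (Unique-++⇒disjoint α (↭oneTo⇒Unique π↭) x∈ (there y∈) x≡y)
... | tri> _ _ y<x = y<x

∈-shifted-oneTo⁻ : ∀ {j a y} → y ∈ map (j +_) (oneTo a) → j < y × y ≤ j + a
∈-shifted-oneTo⁻ {j} y∈ with ∈-map⁻ (j +_) y∈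
... | x , x∈ , refl = ℕₚ.m<m+n j (proj₁ (∈-oneTo⁻ x∈)) , ℕₚ.+-monoʳ-≤ j (proj₂ (∈-oneTo⁻ x∈))

∈-shifted-oneTo⁺ : ∀ {j a x} → 1 ≤ x → x ≤ a → j + x ∈ map (j +_) (oneTo a)
∈-shifted-oneTo⁺ {j} 1≤x x≤a = ∈-map⁺ (j +_) (∈-oneTo⁺ 1≤x x≤a)

split-shifted-block : ∀ {t} j i α rest → j + suc i ≡ suc t → Even t → α ↭ map (j +_) (oneTo (suc i)) →
  Dumont (α ++ rest) → ∃ λ α₀ → α ≡ map (j +_) α₀ ++ [ suc t ] × α₀ ↭ oneTo i
split-shifted-block {t} j i α rest M≡ et α↭ d
  with odd-max-last α rest d
         (Permₚ.∈-resp-↭ (↭-sym α↭) (subst (_∈ map (j +_) (oneTo (suc i))) M≡ (∈-shifted-oneTo⁺ (s≤s z≤n) ℕₚ.≤-refl)))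
         (Even⇒Odd-suc et)
         (All.tabulate (λ {x} x∈ → subst (x ≤_) M≡ (proj₂ (∈-shifted-oneTo⁻ {j} (Permₚ.∈-resp-↭ α↭ x∈)))))
... | α₁ , refl with unshift-↭oneTo j i α₁ (++[x]-cancel-↭ α₁ _ (suc t) (↭-trans α↭ (↭-reflexive shifted-snoc)))
  where
  shifted-snoc : map (j +_) (oneTo (suc i)) ≡ map (j +_) (oneTo i) ++ [ suc t ]
  shifted-snoc = trans (cong (map (j +_)) (oneTo-snoc i))
    (trans (Listₚ.map-++ (j +_) (oneTo i) [ suc i ]) (cong (λ x → map (j +_) (oneTo i) ++ [ x ]) M≡))
... | α₁≡ , α₀↭ = map (_∸ j) α₁ , cong (_++ [ suc t ]) α₁≡ , α₀↭

data Shape (t : ℕ) : List ℕ → Set where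
  maxFirst-shape : ∀ {β} → β ↭ oneTo t → Dumont β → Shape t (maxFirst t β)
  maxInside-shape : ∀ {i α β} → i < t → α ↭ oneTo i → β ↭ oneTo (t ∸ i) → Dumont α → Dumont β → Even i →
    Shape t (maxInside t i α β)

shape-maxFirst : ∀ {t β} → Even t → β ↭ oneTo (suc t) → Dumont β → Shape t (suc (suc t) ∷ β)
shape-maxFirst et β↭ d with odd-length-shape et β↭ d
... | β₁ , refl , β₁↭ , dβ₁ = maxFirst-shape β₁↭ dβ₁

-- The least entry |β| + 1 of α would be even and followed by a larger entry.
odd-gap-impossible : ∀ {t} α β → Dumont (α ++ suc (suc t) ∷ β) → α ↭ map (length β +_) (oneTo (length α)) →
  length α + length β ≡ suc t → 1 ≤ length α → Odd (length β) → ⊥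
odd-gap-impossible {t} α β d α↭ len 1≤|α| odd =
  even-min-ascent-impossible α (suc (suc t)) β d m∈ (Odd⇒Even-suc odd) m≤α m<N
  where
  j = length β
  m∈ : suc j ∈ α
  m∈ = Permₚ.∈-resp-↭ (↭-sym α↭)
         (subst (_∈ map (j +_) (oneTo (length α))) (ℕₚ.+-comm j 1) (∈-shifted-oneTo⁺ ℕₚ.≤-refl 1≤|α|))
  m≤α : All (suc j ≤_) α
  m≤α = All.tabulate (λ x∈ → proj₁ (∈-shifted-oneTo⁻ (Permₚ.∈-resp-↭ α↭ x∈)))
  m<N : suc j < suc (suc t)
  m<N = s≤s (s≤s (ℕₚ.≤-pred (ℕₚ.≤-trans (ℕₚ.+-monoˡ-≤ j 1≤|α|) (ℕₚ.≤-reflexive len))))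

shape-maxInside : ∀ {t} α b β′ → Even t → Dumont (α ++ suc (suc t) ∷ b ∷ β′) →
  α ↭ map (suc (length β′) +_) (oneTo (length α)) → b ∷ β′ ↭ oneTo (suc (length β′)) →
  length α + suc (length β′) ≡ suc t → Even (suc (length β′)) → Shape t (α ++ suc (suc t) ∷ b ∷ β′)
shape-maxInside [] b β′ et _ _ _ len ej = ⊥-elim (Even⇒Odd-suc et (subst Even len ej))
shape-maxInside {t} (a ∷ α′) b β′ et d α↭ β↭ len ej with split-shifted-block j i (a ∷ α′) (N ∷ β) M≡ et α↭ d
  where
  N = suc (suc t)
  β = b ∷ β′
  i = length α′
  j = suc (length β′)
  M≡ = trans (ℕₚ.+-comm j (suc i)) len
... | α₀ , α≡ , α₀↭ = subst (λ α → Shape t (α ++ N ∷ β)) (sym α≡) (subst (Shape t) maxInside≡ shape′)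
  where
  N = suc (suc t)
  β = b ∷ β′
  i = length α′
  j = suc (length β′)
  j+i≡t : j + i ≡ t
  j+i≡t = ℕₚ.suc-injective (trans (sym (ℕₚ.+-suc j i)) (trans (ℕₚ.+-comm j (suc i)) len))
  t∸i≡j : t ∸ i ≡ j
  t∸i≡j = trans (cong (_∸ i) (sym j+i≡t)) (ℕₚ.m+n∸n≡m j i)
  maxInside≡ : maxInside t i α₀ β ≡ (map (j +_) α₀ ++ [ suc t ]) ++ N ∷ β
  maxInside≡ = trans (cong (λ k → map (k +_) α₀ ++ suc t ∷ N ∷ β) t∸i≡j)
                     (sym (Listₚ.++-assoc (map (j +_) α₀) [ suc t ] (N ∷ β)))
  d′ : Dumont (map (j +_) α₀ ++ suc t ∷ N ∷ β)
  d′ = subst Dumont (trans (cong (_++ N ∷ β) α≡) (Listₚ.++-assoc (map (j +_) α₀) [ suc t ] (N ∷ β))) d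
  α₀↑<1+t : All (_< suc t) (map (j +_) α₀)
  α₀↑<1+t = All.map (λ (_ , x≤) → s≤s (subst (_ ≤_) j+i≡t x≤)) (shift-bounds j α₀↭)
  shape′ : Shape t (maxInside t i α₀ β)
  shape′ = maxInside-shape (subst (i <_) j+i≡t (s≤s (ℕₚ.m≤n+m i (length β′))))
    α₀↭ (subst (λ n → β ↭ oneTo n) (sym t∸i≡j) β↭)
    (Dumont-shift⁻ ej α₀ (Dumont-++⁻ˡ (map (j +_) α₀) (suc t) (N ∷ β) d′ α₀↑<1+t))
    (Dumont-tail N β (Dumont-++⁻ʳ (map (j +_) α₀ ++ [ suc t ]) (subst Dumont (cong (_++ N ∷ β) α≡) d)))
    (Even-+⁻ ej (subst Even (sym j+i≡t) et))

shape : ∀ {t π} → Even t → π ↭ oneTo (2 + t) → Dumont π → Avoids p132 π → Shape t π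
shape {t} et π↭ d av with ∈-∃++ (↭oneTo⇒max∈ π↭)
... | α , [] , refl = ⊥-elim (Dumont-last α _ d (Even-2+ et))
... | α , b ∷ β′ , refl = around-max α d blocks len
  where
  N = suc (suc t)
  β = b ∷ β′
  αβ↭ = ↭oneTo-remove-max α β π↭
  blocks = ↭oneTo-blocks (suc t) α β αβ↭ (Above-around-max α N β π↭ av)
  len : length α + length β ≡ suc t
  len = trans (sym (Listₚ.length-++ α)) (↭oneTo⇒length αβ↭)
  around-max : ∀ α → Dumont (α ++ N ∷ β) → β ↭ oneTo (length β) × α ↭ map (length β +_) (oneTo (length α)) →
    length α + length β ≡ suc t → Shape t (α ++ N ∷ β)
  around-max [] d (β↭ , _) len = shape-maxFirst et (subst (λ n → β ↭ oneTo n) len β↭) (Dumont-tail N β d)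
  around-max (a ∷ α′) d (β↭ , α↭) len with Even? (length β)
  ... | inj₁ ej = shape-maxInside (a ∷ α′) b β′ et d α↭ β↭ len ej
  ... | inj₂ oj = ⊥-elim (odd-gap-impossible (a ∷ α′) β d α↭ len (s≤s z≤n) oj)

-- Enumeration

DumontClass : (List ℕ → Set) → ℕ → List ℕ → Set
DumontClass Av n π = Even n × π ↭ oneTo n × Dumont π × Avoids p132 π × Av π

Enumerates : (List ℕ → Set) → List (List ℕ) → Set
Enumerates P xs = Unique xs × (∀ π → π ∈ xs ⇔ P π)

maxInsides : (ℕ → List (List ℕ)) → (ℕ → List (List ℕ)) → ℕ → ℕ → List (List ℕ)
maxInsides B C t i = concatMap (λ α → map (maxInside t i α) (C (t ∸ i))) (B i)

assemble : List (List ℕ) → (ℕ → List (List ℕ)) → (ℕ → List (List ℕ)) → ℕ → List (List ℕ)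
assemble A B C t = map (maxFirst t) A ++ concatMap (maxInsides B C t) (upTo t)

data Assembled (A : List (List ℕ)) (B C : ℕ → List (List ℕ)) (t : ℕ) : List ℕ → Set where
  first : ∀ {β} → β ∈ A → Assembled A B C t (maxFirst t β)
  inside : ∀ {i α β} → i < t → α ∈ B i → β ∈ C (t ∸ i) → Assembled A B C t (maxInside t i α β)

module _ {B C : ℕ → List (List ℕ)} {t : ℕ} where

  ∈-maxInsides⁻ : ∀ {i π} → π ∈ maxInsides B C t i →
    ∃₂ λ α β → α ∈ B i × β ∈ C (t ∸ i) × π ≡ maxInside t i α β
  ∈-maxInsides⁻ {i} π∈ with find (∈-concatMap⁻ (λ α → map (maxInside t i α) (C (t ∸ i))) {xs = B i} π∈)
  ... | α , α∈ , π∈′ with ∈-map⁻ (maxInside t i α) π∈′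
  ... | β , β∈ , refl = α , β , α∈ , β∈ , refl

  ∈-all-maxInsides⁻ : ∀ {π} → π ∈ concatMap (maxInsides B C t) (upTo t) →
    ∃₂ λ i α → ∃ λ β → i < t × α ∈ B i × β ∈ C (t ∸ i) × π ≡ maxInside t i α β
  ∈-all-maxInsides⁻ π∈ with find (∈-concatMap⁻ (maxInsides B C t) {xs = upTo t} π∈)
  ... | i , i∈ , π∈′ with ∈-maxInsides⁻ π∈′
  ... | α , β , α∈ , β∈ , eq = i , α , β , ∈-upTo⁻ i∈ , α∈ , β∈ , eq

module _ {A : List (List ℕ)} {B C : ℕ → List (List ℕ)} {t : ℕ} where

  ∈-assemble⁻ : ∀ {π} → π ∈ assemble A B C t → Assembled A B C t π
  ∈-assemble⁻ π∈ with ∈-++⁻ (map (maxFirst t) A) π∈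
  ... | inj₁ π∈A with ∈-map⁻ (maxFirst t) π∈A
  ...   | β , β∈ , refl = first β∈
  ∈-assemble⁻ π∈ | inj₂ π∈BC with ∈-all-maxInsides⁻ {B} {C} {t} π∈BC
  ...   | i , α , β , i<t , α∈ , β∈ , refl = inside i<t α∈ β∈

  ∈-assemble⁺ : ∀ {π} → Assembled A B C t π → π ∈ assemble A B C t
  ∈-assemble⁺ (first β∈) = ∈-++⁺ˡ (∈-map⁺ (maxFirst t) β∈)
  ∈-assemble⁺ (inside {i} {α} i<t α∈ β∈) = ∈-++⁺ʳ (map (maxFirst t) A)
    (∈-concatMap⁺ (maxInsides B C t) (lose (∈-upTo⁺ i<t)
      (∈-concatMap⁺ (λ α → map (maxInside t i α) (C (t ∸ i))) (lose α∈ (∈-map⁺ (maxInside t i α) β∈)))))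

++-∷-cancel-below : ∀ {x} xs xs′ {ys ys′ : List ℕ} → All (_< x) xs → All (_< x) xs′ →
  xs ++ x ∷ ys ≡ xs′ ++ x ∷ ys′ → xs ≡ xs′ × ys ≡ ys′
++-∷-cancel-below [] [] _ _ eq = refl , Listₚ.∷-injectiveʳ eq
++-∷-cancel-below [] (y ∷ _) _ (y<x ∷ _) eq = ⊥-elim (ℕₚ.<-irrefl (sym (Listₚ.∷-injectiveˡ eq)) y<x)
++-∷-cancel-below (y ∷ _) [] (y<x ∷ _) _ eq = ⊥-elim (ℕₚ.<-irrefl (Listₚ.∷-injectiveˡ eq) y<x)
++-∷-cancel-below (a ∷ xs) (b ∷ xs′) (_ ∷ xs<x) (_ ∷ xs′<x) eq with Listₚ.∷-injective eq
... | refl , eq′ with ++-∷-cancel-below xs xs′ xs<x xs′<x eq′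
... | refl , ys≡ = refl , ys≡

maxFirst-injective : ∀ {t β β′} → maxFirst t β ≡ maxFirst t β′ → β ≡ β′
maxFirst-injective {β = β} {β′} eq = Listₚ.∷ʳ-injectiveˡ β β′ (Listₚ.∷-injectiveʳ eq)

maxInside-injective : ∀ {t i i′ α α′ β β′} → i ≤ t → i′ ≤ t → α ↭ oneTo i → α′ ↭ oneTo i′ →
  maxInside t i α β ≡ maxInside t i′ α′ β′ → i ≡ i′ × α ≡ α′ × β ≡ β′
maxInside-injective {t} {i} {i′} {α} {α′} i≤t i′≤t α↭ α′↭ eq
  with ++-∷-cancel-below _ _ (shifted-below-1+t i≤t α↭) (shifted-below-1+t i′≤t α′↭) eq
... | α↑≡ , Nβ≡ with i≡i′
  where
  i≡i′ : i ≡ i′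
  i≡i′ = trans (sym (↭oneTo⇒length α↭)) (trans (sym (Listₚ.length-map ((t ∸ i) +_) α))
           (trans (cong length α↑≡) (trans (Listₚ.length-map ((t ∸ i′) +_) α′) (↭oneTo⇒length α′↭))))
... | refl = refl , Listₚ.map-injective (ℕₚ.+-cancelˡ-≡ (t ∸ i) _ _) α↑≡ , Listₚ.∷-injectiveʳ Nβ≡

maxFirst≢maxInside : ∀ {t i α β β′} → i ≤ t → α ↭ oneTo i → maxFirst t β ≢ maxInside t i α β′
maxFirst≢maxInside {α = []} _ _ eq = ℕₚ.<-irrefl (sym (Listₚ.∷-injectiveˡ eq)) (ℕₚ.n<1+n _)
maxFirst≢maxInside {t} {α = a ∷ α} i≤t α↭ eq with shifted-below-1+t i≤t α↭
... | a↑<1+t ∷ _ = ℕₚ.<-irrefl (sym (Listₚ.∷-injectiveˡ eq)) (ℕₚ.m<n⇒m<1+n a↑<1+t)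

Unique-map-injective-on : ∀ {B : Set} {f : List ℕ → B} {xs} → (∀ {x y} → x ∈ xs → y ∈ xs → f x ≡ f y → x ≡ y) →
  Unique xs → Unique (map f xs)
Unique-map-injective-on {xs = []} _ [] = []
Unique-map-injective-on {f = f} {xs = x ∷ xs} inj (x∉ ∷ xs!) =
  All.tabulate (λ fy∈ → fresh fy∈) ∷ Unique-map-injective-on (λ x∈ y∈ → inj (there x∈) (there y∈)) xs!
  where
  fresh : ∀ {v} → v ∈ map f xs → f x ≢ v
  fresh v∈ refl with ∈-map⁻ f v∈
  ... | y , y∈ , fx≡fy = All.lookup x∉ y∈ (inj (here refl) (there y∈) fx≡fy)

Unique-concatMap : ∀ {A B : Set} (f : A → List B) {xs} → Unique xs → (∀ {x} → x ∈ xs → Unique (f x)) →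
  (∀ {x y v} → x ∈ xs → y ∈ xs → v ∈ f x → v ∈ f y → x ≡ y) → Unique (concatMap f xs)
Unique-concatMap f {[]} _ _ _ = []
Unique-concatMap f {x ∷ xs} (x∉ ∷ xs!) f! fibres = Uniqueₚ.++⁺ (f! (here refl))
  (Unique-concatMap f xs! (f! ∘ there) (λ x∈ y∈ → fibres (there x∈) (there y∈))) disjoint
  where
  disjoint : ∀ {v} → ¬ (v ∈ f x × v ∈ concatMap f xs)
  disjoint (v∈fx , v∈) with find (∈-concatMap⁻ f {xs = xs} v∈)
  ... | y , y∈ , v∈fy = All.lookup x∉ y∈ (fibres (here refl) (there y∈) v∈fx v∈fy)

maxInside-injectiveʳ : ∀ {t i α β β′} → maxInside t i α β ≡ maxInside t i α β′ → β ≡ β′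
maxInside-injectiveʳ {t} {i} {α} eq =
  Listₚ.∷-injectiveʳ (Listₚ.∷-injectiveʳ (Listₚ.++-cancelˡ (map ((t ∸ i) +_) α) _ _ eq))

module _ {Av Avʰ Avˡ : List ℕ → Set}
  (maxFirst-transfer : ∀ {t β} → β ↭ oneTo t → Av (maxFirst t β) ⇔ Avʰ β)
  (maxInside-transfer : ∀ {t i α β} → i < t → α ↭ oneTo i → β ↭ oneTo (t ∸ i) →
                        Av (maxInside t i α β) ⇔ (Avˡ α × Av β))
  {A : List (List ℕ)} {B C : ℕ → List (List ℕ)} {t : ℕ}
  (A-enum : Enumerates (DumontClass Avʰ t) A)
  (B-enum : ∀ i → i < t → Enumerates (DumontClass Avˡ i) (B i))
  (C-enum : ∀ u → 1 ≤ u → u ≤ t → Enumerates (DumontClass Av u) (C u))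
  where

  private
    C-enum′ : ∀ i → i < t → Enumerates (DumontClass Av (t ∸ i)) (C (t ∸ i))
    C-enum′ i i<t = C-enum (t ∸ i) (ℕₚ.m<n⇒0<n∸m i<t) (ℕₚ.m∸n≤m t i)

    B-perm : ∀ {i α} → i < t → α ∈ B i → α ↭ oneTo i
    B-perm {i} i<t α∈ = proj₁ (proj₂ (Equivalence.to (proj₂ (B-enum i i<t) _) α∈))

  assembled-sound : ∀ {π} → Assembled A B C t π → DumontClass Av (2 + t) π
  assembled-sound (first {β} β∈) with Equivalence.to (proj₂ A-enum β) β∈
  ... | et , β↭ , dβ , β-132 , avβ = Even-2+ et , maxFirst-↭ β↭ , maxFirst-Dumont et β↭ dβ ,
        maxFirst-avoids132 β↭ β-132 , Equivalence.from (maxFirst-transfer β↭) avβ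
  assembled-sound (inside {i} {α} {β} i<t α∈ β∈)
    with Equivalence.to (proj₂ (B-enum i i<t) α) α∈ | Equivalence.to (proj₂ (C-enum′ i i<t) β) β∈
  ... | ei , α↭ , dα , α-132 , avα | ej , β↭ , dβ , β-132 , avβ =
    Even-2+ et , maxInside-↭ i≤t α↭ β↭ , maxInside-Dumont et ej i≤t α↭ β↭ (ℕₚ.m<n⇒0<n∸m i<t) dα dβ ,
    maxInside-avoids132 i≤t α↭ β↭ α-132 β-132 , Equivalence.from (maxInside-transfer i<t α↭ β↭) (avα , avβ)
    where
    i≤t = ℕₚ.<⇒≤ i<t
    et = subst Even (ℕₚ.m∸n+n≡m i≤t) (Even-+ ej ei)

  shape-assembled : ∀ {π} → DumontClass Av (2 + t) π → Assembled A B C t π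
  shape-assembled (e , π↭ , d , π-132 , av) with shape (Even-2+⁻ e) π↭ d π-132
  ... | maxFirst-shape {β} β↭ dβ = first (Equivalence.from (proj₂ A-enum β)
        (Even-2+⁻ e , β↭ , dβ , Avoids-⊆ π-132 (β⊆maxFirst t β) , Equivalence.to (maxFirst-transfer β↭) av))
  ... | maxInside-shape {i} {α} {β} i<t α↭ β↭ dα dβ ei with Equivalence.to (maxInside-transfer i<t α↭ β↭) av
  ...   | avα , avβ = inside i<t
          (Equivalence.from (proj₂ (B-enum i i<t) α)
            (ei , α↭ , dα , Avoids-shift⁻ (t ∸ i) (Avoids-⊆ π-132 (⊆-++ʳ (map ((t ∸ i) +_) α))) , avα))
          (Equivalence.from (proj₂ (C-enum′ i i<t) β)
            (ej , β↭ , dβ , Avoids-⊆ π-132 (β⊆maxInside t i α β) , avβ))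
    where
    ej = Even-+⁻ ei (subst Even (sym (ℕₚ.m+[n∸m]≡n (ℕₚ.<⇒≤ i<t))) (Even-2+⁻ e))

  assemble-unique : Unique (assemble A B C t)
  assemble-unique = Uniqueₚ.++⁺ (Uniqueₚ.map⁺ maxFirst-injective (proj₁ A-enum))
    (Unique-concatMap (maxInsides B C t) (Uniqueₚ.upTo⁺ t) maxInsides-unique same-i) first≢inside
    where
    maxInsides-unique : ∀ {i} → i ∈ upTo t → Unique (maxInsides B C t i)
    maxInsides-unique {i} i∈ = Unique-concatMap (λ α → map (maxInside t i α) (C (t ∸ i))) (proj₁ (B-enum i i<t))
      (λ _ → Uniqueₚ.map⁺ (maxInside-injectiveʳ {t} {i}) (proj₁ (C-enum′ i i<t))) same-α
      where
      i<t = ∈-upTo⁻ i∈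
      same-α : ∀ {α α′ π} → α ∈ B i → α′ ∈ B i →
        π ∈ map (maxInside t i α) (C (t ∸ i)) → π ∈ map (maxInside t i α′) (C (t ∸ i)) → α ≡ α′
      same-α {α} {α′} α∈ α′∈ π∈ π∈′ with ∈-map⁻ (maxInside t i α) π∈ | ∈-map⁻ (maxInside t i α′) π∈′
      ... | _ , _ , refl | _ , _ , eq =
        proj₁ (proj₂ (maxInside-injective (ℕₚ.<⇒≤ i<t) (ℕₚ.<⇒≤ i<t) (B-perm i<t α∈) (B-perm i<t α′∈) eq))
    same-i : ∀ {i i′ π} → i ∈ upTo t → i′ ∈ upTo t → π ∈ maxInsides B C t i → π ∈ maxInsides B C t i′ → i ≡ i′
    same-i i∈ i′∈ π∈ π∈′ with ∈-maxInsides⁻ {B} {C} {t} π∈ | ∈-maxInsides⁻ {B} {C} {t} π∈′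
    ... | _ , _ , α∈ , _ , refl | _ , _ , α′∈ , _ , eq =
      proj₁ (maxInside-injective (ℕₚ.<⇒≤ (∈-upTo⁻ i∈)) (ℕₚ.<⇒≤ (∈-upTo⁻ i′∈))
                                 (B-perm (∈-upTo⁻ i∈) α∈) (B-perm (∈-upTo⁻ i′∈) α′∈) eq)
    first≢inside : ∀ {π} → ¬ (π ∈ map (maxFirst t) A × π ∈ concatMap (maxInsides B C t) (upTo t))
    first≢inside (π∈A , π∈BC) with ∈-map⁻ (maxFirst t) π∈A | ∈-all-maxInsides⁻ {B} {C} {t} π∈BC
    ... | _ , _ , refl | _ , _ , _ , i<t , α∈ , _ , eq = maxFirst≢maxInside (ℕₚ.<⇒≤ i<t) (B-perm i<t α∈) eq

  assemble-enumerates : Enumerates (DumontClass Av (2 + t)) (assemble A B C t)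
  assemble-enumerates = assemble-unique , λ π → mk⇔ (assembled-sound ∘ ∈-assemble⁻) (∈-assemble⁺ ∘ shape-assembled)

-- grow T i n computes the entry of length suc n, from entries T of length at most n.
module CourseOfValues {I X : Set} (base : I → X) (grow : (I → ℕ → X) → I → ℕ → X) where

  stage : ℕ → I → ℕ → X
  stage zero i t = base i
  stage (suc n) i t with t ≤? n
  ... | yes _ = stage n i t
  ... | no _ = grow (stage n) i n

  value : I → ℕ → X
  value i t = stage t i t

  value-suc : ∀ i n → value i (suc n) ≡ grow (stage n) i n
  value-suc i n with suc n ≤? n
  ... | yes 1+n≤n = ⊥-elim (ℕₚ.<-irrefl refl 1+n≤n)
  ... | no _ = refl

  stage-stable : ∀ i {t n} → t ≤ n → stage n i t ≡ value i t
  stage-stable i {n = zero} z≤n = refl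
  stage-stable i {t} {suc n} t≤1+n with t ≤? n
  ... | yes t≤n = stage-stable i t≤n
  ... | no t≰n with ℕₚ.≤-antisym t≤1+n (ℕₚ.≰⇒> t≰n)
  ...   | refl = sym (value-suc i n)

data Family : Set where
  increasing : ℕ → Family
  dip : ℕ → Family

forbidden : Family → List ℕ
forbidden (increasing r) = oneTo r
forbidden (dip q) = p23k1 (3 + q)

avoiders-base : Family → List (List ℕ)
avoiders-base (increasing zero) = []
avoiders-base _ = [ [] ]

avoiders-grow : (Family → ℕ → List (List ℕ)) → Family → ℕ → List (List ℕ)
avoiders-grow T (increasing (suc (suc r))) (suc t) =
  assemble (T (increasing (suc r)) t) (T (increasing r)) (T (increasing (suc (suc r)))) t
avoiders-grow T (dip q) (suc t) = assemble (T (dip q) t) (T (increasing q)) (T (dip q)) t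
avoiders-grow T _ _ = []

open CourseOfValues avoiders-base avoiders-grow using (stage; value-suc; stage-stable)
  renaming (value to avoiders)

Class : Family → ℕ → List ℕ → Set
Class F = DumontClass (Avoids (forbidden F))

Contains-[] : ∀ π → Contains [] π
Contains-[] π = [] , minimum π , tt

Avoids-[] : ∀ {σ} → σ ≢ [] → Avoids σ []
Avoids-[] {[]} σ≢[] _ = σ≢[] refl
Avoids-[] {_ ∷ _} _ ([] , [] , ())

nothing-enumerates-¬ : ∀ {P : List ℕ → Set} → (∀ {π} → ¬ P π) → Enumerates P []
nothing-enumerates-¬ ¬P = [] , λ π → mk⇔ (λ ()) (⊥-elim ∘ ¬P)

avoiders-zero : ∀ F → Enumerates (Class F 0) (avoiders-base F)
avoiders-zero (increasing zero) = nothing-enumerates-¬ (λ c → proj₂ (proj₂ (proj₂ (proj₂ c))) (Contains-[] _))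
avoiders-zero (increasing (suc r)) = [] ∷ [] , λ π → mk⇔
  (λ { (here refl) → divides 0 refl , ↭-refl , tt , Avoids-[] (λ ()) , Avoids-[] (λ ()) })
  (λ (_ , π↭ , _) → here (Permₚ.↭-empty-inv π↭))
avoiders-zero (dip q) = [] ∷ [] , λ π → mk⇔
  (λ { (here refl) → divides 0 refl , ↭-refl , tt , Avoids-[] (λ ()) , Avoids-[] (λ ()) })
  (λ (_ , π↭ , _) → here (Permₚ.↭-empty-inv π↭))

IH : ℕ → Set
IH n = ∀ m → m ≤ n → ∀ F → Enumerates (Class F m) (stage n F m)

avoiders-grow-enumerates : ∀ n → IH n → ∀ F → Enumerates (Class F (suc n)) (avoiders-grow (stage n) F n)
avoiders-grow-enumerates n ih (increasing zero) =
  nothing-enumerates-¬ (λ c → proj₂ (proj₂ (proj₂ (proj₂ c))) (Contains-[] _))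
avoiders-grow-enumerates n ih (increasing (suc zero)) = nothing-enumerates-¬ nonempty
  where
  nonempty : ∀ {π} → ¬ Class (increasing 1) (suc n) π
  nonempty {[]} (_ , π↭ , _) with Permₚ.↭-length π↭
  ... | ()
  nonempty {x ∷ π} (_ , _ , _ , _ , av) = av (x ∷ [] , refl ∷ minimum π , ([] , tt))
avoiders-grow-enumerates zero ih (increasing (suc (suc r))) = nothing-enumerates-¬ (λ c → Even⇒Odd-suc (divides 0 refl) (proj₁ c))
avoiders-grow-enumerates zero ih (dip q) = nothing-enumerates-¬ (λ c → Even⇒Odd-suc (divides 0 refl) (proj₁ c))
avoiders-grow-enumerates (suc t) ih (increasing (suc (suc r))) =
  assemble-enumerates (maxFirst-avoids-increasing r) (λ i<t → maxInside-avoids-increasing r (ℕₚ.<⇒≤ i<t))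
    (ih t (ℕₚ.n≤1+n t) (increasing (suc r)))
    (λ i i<t → ih i (ℕₚ.m≤n⇒m≤1+n (ℕₚ.<⇒≤ i<t)) (increasing r))
    (λ u _ u≤t → ih u (ℕₚ.m≤n⇒m≤1+n u≤t) (increasing (suc (suc r))))
avoiders-grow-enumerates (suc t) ih (dip q) =
  assemble-enumerates (maxFirst-avoids-dip q)
    (λ i<t α↭ β↭ → maxInside-avoids-dip q (ℕₚ.<⇒≤ i<t) α↭ β↭ (ℕₚ.m<n⇒0<n∸m i<t))
    (ih t (ℕₚ.n≤1+n t) (dip q))
    (λ i i<t → ih i (ℕₚ.m≤n⇒m≤1+n (ℕₚ.<⇒≤ i<t)) (increasing q))
    (λ u _ u≤t → ih u (ℕₚ.m≤n⇒m≤1+n u≤t) (dip q))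

avoiders-enumerates : ∀ n F → Enumerates (Class F n) (avoiders F n)
avoiders-enumerates = <-rec (λ n → ∀ F → Enumerates (Class F n) (avoiders F n)) step
  where
  step : ∀ n → (∀ {m} → m < n → ∀ F → Enumerates (Class F m) (avoiders F m)) →
    ∀ F → Enumerates (Class F n) (avoiders F n)
  step zero _ F = avoiders-zero F
  step (suc n) rec F = subst (Enumerates (Class F (suc n))) (sym (value-suc F n))
    (avoiders-grow-enumerates n
      (λ m m≤n F′ → subst (Enumerates (Class F′ m)) (sym (stage-stable F′ m≤n)) (rec (s≤s m≤n) F′)) F)

-- Counting

open PowerSeries using (∑; ∑-cong; ⊛-coeff; ⊛-cong; ⊛-⊖𝟙-coeff; ⊛-distribʳ-⊕; ⊛-identityˡ; X⊛-zero; X⊛-suc;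
  ≗𝟙⊕X²⊛; F-unique; RHS-factor)

length-concatMap-applyUpTo : ∀ {B : Set} (f : ℕ → List B) g n →
  ℤ.+ length (concatMap f (applyUpTo g n)) ≡ ∑ n (λ i → ℤ.+ length (f (g i)))
length-concatMap-applyUpTo f g zero = refl
length-concatMap-applyUpTo f g (suc n) = begin
  ℤ.+ length (f (g 0) ++ concatMap f (applyUpTo (g ∘ suc) n))
    ≡⟨ cong ℤ.+_ (Listₚ.length-++ (f (g 0))) ⟩
  ℤ.+ (length (f (g 0)) + length (concatMap f (applyUpTo (g ∘ suc) n)))
    ≡⟨ ℤₚ.pos-+ (length (f (g 0))) _ ⟩
  ℤ.+ length (f (g 0)) ℤ.+ ℤ.+ length (concatMap f (applyUpTo (g ∘ suc) n))
    ≡⟨ cong (ℤ._+_ (ℤ.+ length (f (g 0)))) (length-concatMap-applyUpTo f (g ∘ suc) n) ⟩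
  ∑ (suc n) (λ i → ℤ.+ length (f (g i))) ∎
  where open ≡-Reasoning

length-concatMap-map : ∀ {A B C : Set} (h : A → B → C) (ys : List B) xs →
  length (concatMap (λ x → map (h x) ys) xs) ≡ length xs ℕ.* length ys
length-concatMap-map h ys [] = refl
length-concatMap-map h ys (x ∷ xs) = trans (Listₚ.length-++ (map (h x) ys))
  (cong₂ _+_ (Listₚ.length-map (h x) ys) (length-concatMap-map h ys xs))

length-assemble : ∀ A B C t → ℤ.+ length (assemble A B C t) ≡
  ℤ.+ length A ℤ.+ ∑ t (λ i → ℤ.+ length (B i) ℤ.* ℤ.+ length (C (t ∸ i)))
length-assemble A B C t = begin
  ℤ.+ length (map (maxFirst t) A ++ concatMap (maxInsides B C t) (upTo t))
    ≡⟨ cong ℤ.+_ (Listₚ.length-++ (map (maxFirst t) A)) ⟩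
  ℤ.+ (length (map (maxFirst t) A) + length (concatMap (maxInsides B C t) (upTo t)))
    ≡⟨ ℤₚ.pos-+ (length (map (maxFirst t) A)) _ ⟩
  ℤ.+ length (map (maxFirst t) A) ℤ.+ ℤ.+ length (concatMap (maxInsides B C t) (upTo t))
    ≡⟨ cong₂ ℤ._+_ (cong ℤ.+_ (Listₚ.length-map (maxFirst t) A))
                   (length-concatMap-applyUpTo (maxInsides B C t) (λ i → i) t) ⟩
  ℤ.+ length A ℤ.+ ∑ t (λ i → ℤ.+ length (maxInsides B C t i))
    ≡⟨ cong (ℤ._+_ (ℤ.+ length A)) (∑-cong t (λ i _ → |maxInsides| i)) ⟩
  ℤ.+ length A ℤ.+ ∑ t (λ i → ℤ.+ length (B i) ℤ.* ℤ.+ length (C (t ∸ i))) ∎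
  where
  open ≡-Reasoning
  |maxInsides| : ∀ i → ℤ.+ length (maxInsides B C t i) ≡ ℤ.+ length (B i) ℤ.* ℤ.+ length (C (t ∸ i))
  |maxInsides| i = trans (cong ℤ.+_ (length-concatMap-map (maxInside t i) (C (t ∸ i)) (B i))) (ℤₚ.pos-* (length (B i)) _)

length-assemble-≡ : ∀ {a b c : Series} {A B C t} → ℤ.+ length A ≡ a t → (∀ i → i < t → ℤ.+ length (B i) ≡ b i) →
  (∀ u → 1 ≤ u → u ≤ t → ℤ.+ length (C u) ≡ c u) → c 0 ≡ ℤ.+ 1 →
  ℤ.+ length (assemble A B C t) ≡ (a ⊕ b ⊛ (c ⊖ 𝟙)) t
length-assemble-≡ {a} {b} {c} {A} {B} {C} {t} |A| |B| |C| c₀ = begin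
  ℤ.+ length (assemble A B C t)
    ≡⟨ length-assemble A B C t ⟩
  ℤ.+ length A ℤ.+ ∑ t (λ i → ℤ.+ length (B i) ℤ.* ℤ.+ length (C (t ∸ i)))
    ≡⟨ cong₂ ℤ._+_ |A| (∑-cong t |BC|) ⟩
  a t ℤ.+ ∑ t (λ i → b i ℤ.* c (t ∸ i))
    ≡⟨ cong (ℤ._+_ (a t)) (⊛-⊖𝟙-coeff b c t c₀) ⟨
  (a ⊕ b ⊛ (c ⊖ 𝟙)) t ∎
  where
  open ≡-Reasoning
  |BC| : ∀ i → i < t → ℤ.+ length (B i) ℤ.* ℤ.+ length (C (t ∸ i)) ≡ b i ℤ.* c (t ∸ i)
  |BC| i i<t = cong₂ ℤ._*_ (|B| i i<t) (|C| (t ∸ i) (ℕₚ.m<n⇒0<n∸m i<t) (ℕₚ.m∸n≤m t i))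

count : Family → Series
count F n = ℤ.+ length (avoiders F n)

stage-count : ∀ F {m n} → m ≤ n → ℤ.+ length (stage n F m) ≡ count F m
stage-count F m≤n = cong (ℤ.+_ ∘ length) (stage-stable F m≤n)

count-suc : ∀ F n → count F (suc n) ≡ ℤ.+ length (avoiders-grow (stage n) F n)
count-suc F n = cong (ℤ.+_ ∘ length) (value-suc F n)

count-recurrence : ∀ F {Fʰ Fˡ} → count F 0 ≡ ℤ.+ 1 → (∀ T → avoiders-grow T F 0 ≡ []) →
  (∀ T t → avoiders-grow T F (suc t) ≡ assemble (T Fʰ t) (T Fˡ) (T F) t) →
  count F ≗ 𝟙 ⊕ X ⊛ X ⊛ (count Fʰ ⊕ count Fˡ ⊛ (count F ⊖ 𝟙))
count-recurrence F {Fʰ} {Fˡ} c₀ grow₀ grow₂₊ = ≗𝟙⊕X²⊛ (count Fʰ ⊕ count Fˡ ⊛ (count F ⊖ 𝟙)) c₀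
  (trans (count-suc F 0) (cong (ℤ.+_ ∘ length) (grow₀ (stage 0))))
  λ t → trans (count-suc F (suc t)) (trans (cong (ℤ.+_ ∘ length) (grow₂₊ (stage (suc t)) t))
    (length-assemble-≡ {count Fʰ} {count Fˡ} {count F} {stage (suc t) Fʰ t} {stage (suc t) Fˡ} {stage (suc t) F} {t}
      (stage-count Fʰ (ℕₚ.n≤1+n t))
      (λ i i<t → stage-count Fˡ (ℕₚ.m≤n⇒m≤1+n (ℕₚ.<⇒≤ i<t)))
      (λ u _ u≤t → stage-count F (ℕₚ.m≤n⇒m≤1+n u≤t)) c₀))

count-increasing≗F : ∀ r → count (increasing r) ≗ F r
count-increasing≗F = F-unique (count ∘ increasing) count-increasing-0 count-increasing-1
  (λ r → count-recurrence (increasing (suc (suc r))) refl (λ _ → refl) (λ _ _ → refl))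
  where
  count-increasing-0 : count (increasing 0) ≗ 𝟘
  count-increasing-0 zero = refl
  count-increasing-0 (suc n) = count-suc (increasing 0) n
  count-increasing-1 : count (increasing 1) ≗ 𝟙
  count-increasing-1 zero = refl
  count-increasing-1 (suc n) = count-suc (increasing 1) n

count-dip-recurrence : ∀ q → count (dip q) ≗ 𝟙 ⊕ X ⊛ X ⊛ (count (dip q) ⊕ F q ⊛ (count (dip q) ⊖ 𝟙))
count-dip-recurrence q n = trans (count-recurrence (dip q) refl (λ _ → refl) (λ _ _ → refl) n)
  (cong (ℤ._+_ (𝟙 n)) (⊛-cong {X ⊛ X} (λ _ → refl)
    (λ m → cong (ℤ._+_ (count (dip q) m)) (⊛-cong {g = count (dip q) ⊖ 𝟙} (count-increasing≗F q) (λ _ → refl) m)) n))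

dumontAvoiders : ℕ → ℕ → List (List ℕ)
dumontAvoiders q zero = avoiders (dip q) zero
dumontAvoiders q (suc n) = avoiders (dip q) (suc n) ++ map (_++ [ suc n ]) (avoiders (dip q) n)

DumontAvoider : ℕ → ℕ → List ℕ → Set
DumontAvoider q n π = IsPerm n π × Dumont π × Avoids p132 π × Avoids (p23k1 (3 + q)) π

-- Odd-length members are exactly the even-length ones followed by their new maximum.
dumontAvoiders-enumerates : ∀ q n → Enumerates (DumontAvoider q n) (dumontAvoiders q n)
dumontAvoiders-enumerates q zero = proj₁ (avoiders-enumerates 0 (dip q)) , λ π → mk⇔
  (proj₂ ∘ Equivalence.to (proj₂ (avoiders-enumerates 0 (dip q)) π))
  (Equivalence.from (proj₂ (avoiders-enumerates 0 (dip q)) π) ∘ (divides 0 refl ,_))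
dumontAvoiders-enumerates q (suc n) = Uniqueₚ.++⁺ even! (Uniqueₚ.map⁺ (Listₚ.∷ʳ-injectiveˡ _ _) odd!) even≢odd ,
  λ π → mk⇔ to from
  where
  even = avoiders-enumerates (suc n) (dip q)
  odd = avoiders-enumerates n (dip q)
  even! = proj₁ even
  odd! = proj₁ odd
  even≢odd : ∀ {π} → ¬ (π ∈ avoiders (dip q) (suc n) × π ∈ map (_++ [ suc n ]) (avoiders (dip q) n))
  even≢odd (π∈ , π∈′) with ∈-map⁻ (_++ [ suc n ]) π∈′
  ... | π′ , π′∈ , refl =
    Even⇒Odd-suc (proj₁ (Equivalence.to (proj₂ odd π′) π′∈)) (proj₁ (Equivalence.to (proj₂ even _) π∈))
  to : ∀ {π} → π ∈ dumontAvoiders q (suc n) → DumontAvoider q (suc n) π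
  to π∈ with ∈-++⁻ (avoiders (dip q) (suc n)) π∈
  ... | inj₁ π∈ₑ = proj₂ (Equivalence.to (proj₂ even _) π∈ₑ)
  ... | inj₂ π∈ₒ with ∈-map⁻ (_++ [ suc n ]) π∈ₒ
  ...   | π′ , π′∈ , refl with Equivalence.to (proj₂ odd π′) π′∈
  ...     | en , π′↭ , d , π′-132 , av =
    ↭oneTo-snoc⁺ π′↭ , Dumont-++⁺ π′ (suc n) [] d (↭oneTo⇒All< π′↭) (Even⇒Odd-suc en) ,
    Avoids132-snoc-max π′ (suc n) π′-132 (↭oneTo⇒All< π′↭) , Equivalence.from (snoc-avoids-dip q π′↭) av
  from : ∀ {π} → DumontAvoider q (suc n) π → π ∈ dumontAvoiders q (suc n)
  from {π} (π↭ , d , π-132 , av) with Even? (suc n)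
  ... | inj₁ e = ∈-++⁺ˡ (Equivalence.from (proj₂ even π) (e , π↭ , d , π-132 , av))
  ... | inj₂ o with odd-length-shape (Odd-suc⇒Even o) π↭ d
  ...   | π′ , refl , π′↭ , d′ = ∈-++⁺ʳ (avoiders (dip q) (suc n)) (∈-map⁺ (_++ [ suc n ])
          (Equivalence.from (proj₂ odd π′) (Odd-suc⇒Even o , π′↭ , d′ , Avoids-⊆ π-132 (⊆-++ʳ π′) ,
                                            Equivalence.to (snoc-avoids-dip q π′↭) av)))

length-dumontAvoiders : ∀ q n → ℤ.+ length (dumontAvoiders q n) ≡ ((𝟙 ⊕ X) ⊛ count (dip q)) n
length-dumontAvoiders q n = sym (trans (⊛-distribʳ-⊕ 𝟙 X (count (dip q)) n)
  (trans (cong₂ ℤ._+_ (⊛-identityˡ (count (dip q)) n) refl) (shifted n)))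
  where
  shifted : ∀ n → count (dip q) n ℤ.+ (X ⊛ count (dip q)) n ≡ ℤ.+ length (dumontAvoiders q n)
  shifted zero = trans (cong (ℤ._+_ (count (dip q) 0)) (X⊛-zero (count (dip q)))) (ℤₚ.+-identityʳ _)
  shifted (suc n) = begin
    count (dip q) (suc n) ℤ.+ (X ⊛ count (dip q)) (suc n)
      ≡⟨ cong (ℤ._+_ (count (dip q) (suc n))) (X⊛-suc (count (dip q)) n) ⟩
    count (dip q) (suc n) ℤ.+ count (dip q) n
      ≡⟨ cong (λ m → count (dip q) (suc n) ℤ.+ ℤ.+ m) (Listₚ.length-map (_++ [ suc n ]) (avoiders (dip q) n)) ⟨
    ℤ.+ length (avoiders (dip q) (suc n)) ℤ.+ ℤ.+ length (map (_++ [ suc n ]) (avoiders (dip q) n))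
      ≡⟨ ℤₚ.pos-+ (length (avoiders (dip q) (suc n))) _ ⟨
    ℤ.+ (length (avoiders (dip q) (suc n)) + length (map (_++ [ suc n ]) (avoiders (dip q) n)))
      ≡⟨ cong ℤ.+_ (Listₚ.length-++ (avoiders (dip q) (suc n))) ⟨
    ℤ.+ length (dumontAvoiders q (suc n)) ∎
    where open ≡-Reasoning

theorem2p16 : (k : ℕ) → k ≥ 3 → (n : ℕ) →
  ∃ λ (L : List (List ℕ)) →
    Unique L ×
    (∀ π → π ∈ L ⇔ (IsPerm n π × Dumont π × Avoids p132 π × Avoids (p23k1 k) π)) ×
    ℤ.+ (length L) ≡ RHS k n
theorem2p16 (suc (suc (suc q))) (s≤s (s≤s (s≤s _))) n =
  dumontAvoiders q n , proj₁ enumeration , proj₂ enumeration ,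
  trans (length-dumontAvoiders q n) (sym (RHS-factor q (count-dip-recurrence q) n))
  where
  enumeration = dumontAvoiders-enumerates q n
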